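{- For each nonnegative integer $k$, \[|\mathcal U_{2k+1}(231,321)|=|\mathcal U_{2k+1}(312,321)|=|\mathcal U_{2k+1}(231,312,321)|=|\mathcal U_{2k+1}(132,231,312)|=1.\] For each $k\ge2$, $\mathcal U_{2k+1}(132,321)=\emptyset$.
   Context: The stack-sorting map $s$ on permutations (finite words of distinct positive integers): $s(\text{empty})=\text{empty}$, and if $\pi=LnR$ with $n$ the largest entry, $s(\pi)=s(L)s(R)n$. A permutation is uniquely sorted if it has exactly one preimage under $s$. A permutation avoids $\tau$ if no subsequence has the same relative order as $\tau$; $\mathcal U_n(\tau^{(1)},\dots,\tau^{(r)})$ is the set of uniquely sorted permutations of $[n]$ avoiding all listed patterns. -}

module Defs where

open import Data.Nat using (ℕ; zero; suc; _+_; _*_; _<_; _⊔_)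
open import Data.List using (List; []; _∷_; _++_; upTo; map; foldr; length)
open import Data.List.Relation.Binary.Permutation.Propositional using (_↭_)
open import Data.List.Relation.Binary.Sublist.Propositional using (_⊆_)
open import Data.List.Relation.Binary.Pointwise using (Pointwise)
open import Data.List.Relation.Unary.All using (All)
open import Data.Product using (Σ; _×_; ∃)
open import Data.Nat using (_≟_)
open import Relation.Nullary using (¬_; yes; no)
open import Relation.Binary.PropositionalEquality using (_≡_)
open import Function.Bundles using (_⇔_)

IsPerm : ℕ → List ℕ → Set
IsPerm n π = π ↭ map suc (upTo n)

maxL : List ℕ → ℕ
maxL = foldr _⊔_ 0

record Split : Set where
  constructor _,_
  field
    left  : List ℕ
    right : List ℕ

splitAt : ℕ → List ℕ → Split
splitAt m [] = [] , []
splitAt m (x ∷ xs) with x ≟ m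
... | yes _ = [] , xs
... | no _ with splitAt m xs
...   | (L , R) = (x ∷ L) , R

-- The stack-sorting map  s(LnR) = s(L) s(R) n, computed with fuel
-- (fuel = length of the word is always sufficient).
sFuel : ℕ → List ℕ → List ℕ
sFuel _ [] = []
sFuel zero (x ∷ xs) = x ∷ xs
sFuel (suc f) (x ∷ xs) with splitAt (maxL (x ∷ xs)) (x ∷ xs)
... | (L , R) = sFuel f L ++ sFuel f R ++ (maxL (x ∷ xs) ∷ [])

s : List ℕ → List ℕ
s w = sFuel (length w) w

-- π ∈ S_n is uniquely sorted: exactly one permutation σ of [n] with s(σ) = π.
-- (s preserves the set of entries, so every preimage of π ∈ S_n lies in S_n.)
UniquelySorted : ℕ → List ℕ → Set
UniquelySorted n π =
  Σ (List ℕ) λ σ → IsPerm n σ × s σ ≡ π × (∀ τ → IsPerm n τ → s τ ≡ π → τ ≡ σ)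

data OrdIso : List ℕ → List ℕ → Set where
  [] : OrdIso [] []
  cons : ∀ {x y xs ys} →
         Pointwise (λ x′ y′ → ((x < x′) ⇔ (y < y′)) × ((x′ < x) ⇔ (y′ < y))) xs ys →
         OrdIso xs ys → OrdIso (x ∷ xs) (y ∷ ys)

Contains : List ℕ → List ℕ → Set
Contains π τ = Σ (List ℕ) λ σ → σ ⊆ π × OrdIso σ τ

Avoids : List ℕ → List ℕ → Set
Avoids π τ = ¬ Contains π τ

InU : ℕ → List (List ℕ) → List ℕ → Set
InU n τs π = IsPerm n π × UniquelySorted n π × All (Avoids π) τs

ExactlyOne : (List ℕ → Set) → Set
ExactlyOne P = Σ (List ℕ) λ π → P π × (∀ π′ → P π′ → π′ ≡ π)

p132 p231 p312 p321 : List ℕ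
p132 = 1 ∷ 3 ∷ 2 ∷ []
p231 = 2 ∷ 3 ∷ 1 ∷ []
p312 = 3 ∷ 1 ∷ 2 ∷ []
p321 = 3 ∷ 2 ∷ 1 ∷ []

-- If w is uniquely sorted with last entry m and preimage L m R, then w = s(L) s(R) m, and s(L), s(R)
-- are again uniquely sorted, nonempty unless w = m, and s(L) does not lie entirely below s(R).
-- Induction along this decomposition shows that avoiding 231, 321 (or 312, 321) forces the layered
-- shape 2 1 4 3 … 2k (2k−1) (2k+1), that avoiding 132, 231, 312 forces the valley
-- (k+1) k … 1 (k+2) … (2k+1), and that avoiding 132, 321 allows only lengths 1 and 3.
-- Conversely these words are uniquely sorted and avoid the patterns, and each shape is
-- determined by its set of entries.

module Submission where

open import Defs
open import Data.Nat using (ℕ; zero; suc; _+_; _*_; _≤_; _<_; _⊓_; _∸_; z≤n; s≤s; _≟_; ⌊_/2⌋)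
open import Data.Nat.Properties
open import Data.Nat.Induction using (<-wellFounded)
open import Data.Product using (Σ; ∃; ∃₂; _×_; proj₁; proj₂; _,_)
open import Data.Sum using (_⊎_; inj₁; inj₂)
open import Data.Unit using (⊤; tt)
open import Data.Empty using (⊥; ⊥-elim)
open import Data.List using (List; []; _∷_; _++_; length; map; upTo; reverse; take; drop; initLast; _∷ʳ′_)
open import Data.List.Properties
  using ( ∷-injective; ∷-injectiveˡ; ∷-injectiveʳ; ∷ʳ-injective; ++-assoc; ++-identityʳ; ++-identityʳ-unique
        ; ++-cancelˡ; ++-cancelʳ; ++-conicalʳ; length-++; length-++-sucʳ; length-++-≤ˡ; length-++-≤ʳ
        ; length-map; length-upTo; length-take; length-drop; length-reverse; upTo-∷ʳ; map-++
        ; take++drop≡id; unfold-reverse; reverse-injective )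
open import Data.List.Membership.Propositional using (_∈_; _∉_)
open import Data.List.Membership.Propositional.Properties using (∈-++⁺ˡ; ∈-++⁺ʳ)
open import Data.List.Relation.Unary.Any using (here; there)
open import Data.List.Relation.Unary.All as All using (All; []; _∷_)
import Data.List.Relation.Unary.All.Properties as All
open import Data.List.Relation.Unary.AllPairs as AllPairs using (AllPairs; []; _∷_)
import Data.List.Relation.Unary.AllPairs.Properties as AllPairsₚ
open import Data.List.Relation.Unary.Unique.Propositional using (Unique)
open import Data.List.Relation.Binary.Pointwise using ([]; _∷_)
open import Data.List.Relation.Binary.Permutation.Propositional
  using (_↭_; ↭-refl; ↭-sym; ↭-trans; ↭-reflexive; ↭-swap; module PermutationReasoning)
import Data.List.Relation.Binary.Permutation.Propositional as ↭
open import Data.List.Relation.Binary.Permutation.Propositional.Properties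
  using (∈-resp-↭; All-resp-↭; ↭-length; ↭-reverse; ++⁺ˡ; ++⁺ʳ; ++-comm; drop-∷) renaming (++⁺ to ↭-++⁺)
open import Data.List.Relation.Binary.Sublist.Propositional
  using (_⊆_; []; _∷_; _∷ʳ_; ⊆-refl; ⊆-trans; from∈; minimum) renaming (lookup to ⊆-lookup)
import Data.List.Relation.Binary.Sublist.Propositional.Properties as ⊆
open import Function using (_on_; _∘′_; case_of_; flip)
open import Function.Bundles using (_⇔_; mk⇔; Equivalence)
open import Induction.WellFounded using (Acc; acc; WellFounded)
open import Relation.Binary.Construct.On as On using ()
open import Relation.Binary.Definitions using (tri<; tri≈; tri>)
open import Relation.Binary.PropositionalEquality
open import Relation.Nullary using (¬_; yes; no)

length-++-∷ˡ : ∀ {A : Set} L {m : A} R → length L < length (L ++ m ∷ R)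
length-++-∷ˡ L R = subst (length L <_) (sym (length-++ L)) (m<m+n (length L) (s≤s z≤n))

length-++-∷ʳ : ∀ {A : Set} L {m : A} R → length R < length (L ++ m ∷ R)
length-++-∷ʳ L R = subst (length R <_) (sym (length-++ L)) (m≤n+m (suc (length R)) (length L))

length-∷ʳ : ∀ {A : Set} xs {x : A} → length (xs ++ x ∷ []) ≡ suc (length xs)
length-∷ʳ xs = trans (length-++ xs) (+-comm (length xs) 1)

length-wellFounded : ∀ {A : Set} → WellFounded (_<_ on length {A = A})
length-wellFounded = On.wellFounded length <-wellFounded

∷≢[] : ∀ {x : ℕ} {xs : List ℕ} → x ∷ xs ≢ []
∷≢[] ()

∷≡∷ʳ⇒[] : ∀ {z : ℕ} R → z ∉ R → z ∷ R ≡ R ++ z ∷ [] → R ≡ []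
∷≡∷ʳ⇒[] []      _  _ = refl
∷≡∷ʳ⇒[] (r ∷ R) z∉ e = ⊥-elim (z∉ (here (∷-injectiveˡ e)))

[]-or-∷ʳ : ∀ {A : Set} (v : List A) → v ≡ [] ⊎ ∃₂ λ V y → v ≡ V ++ y ∷ []
[]-or-∷ʳ v with initLast v
... | []      = inj₁ refl
... | V ∷ʳ′ y = inj₂ (V , y , refl)

++-∷ʳ-injective : ∀ X {Y} Z {y a : ℕ} → X ++ Y ++ y ∷ [] ≡ Z ++ a ∷ [] → X ++ Y ≡ Z × y ≡ a
++-∷ʳ-injective X {Y} Z e = ∷ʳ-injective (X ++ Y) Z (trans (++-assoc X Y _) e)

++-∷-injectiveˡ : ∀ {m : ℕ} X X′ {Y Y′} → m ∉ X → m ∉ X′ → X ++ m ∷ Y ≡ X′ ++ m ∷ Y′ → X ≡ X′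
++-∷-injectiveˡ []      []       _ _  _ = refl
++-∷-injectiveˡ []      (_ ∷ _)  _ m∉ e = ⊥-elim (m∉ (here (∷-injectiveˡ e)))
++-∷-injectiveˡ (_ ∷ _) []       m∉ _ e = ⊥-elim (m∉ (here (sym (∷-injectiveˡ e))))
++-∷-injectiveˡ (x ∷ X) (_ ∷ X′) m∉ m∉′ e =
  cong₂ _∷_ (∷-injectiveˡ e) (++-∷-injectiveˡ X X′ (m∉ ∘′ there) (m∉′ ∘′ there) (∷-injectiveʳ e))

++-split : ∀ (X Y U V : List ℕ) → X ++ Y ≡ U ++ V →
  (∃ λ M → X ≡ U ++ M × V ≡ M ++ Y) ⊎ (∃ λ M → U ≡ X ++ M × Y ≡ M ++ V)
++-split X       Y []      V e = inj₁ (X , refl , sym e)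
++-split []      Y (u ∷ U) V e = inj₂ (u ∷ U , refl , e)
++-split (x ∷ X) Y (u ∷ U) V e with ∷-injective e
... | refl , e′ with ++-split X Y U V e′
...   | inj₁ (M , refl , V≡) = inj₁ (M , refl , V≡)
...   | inj₂ (M , refl , Y≡) = inj₂ (M , refl , Y≡)

++-injective-length : ∀ (X Y X′ Y′ : List ℕ) → length X ≡ length X′ → X ++ Y ≡ X′ ++ Y′ → X ≡ X′ × Y ≡ Y′
++-injective-length []      Y []       Y′ _   e = refl , e
++-injective-length (x ∷ X) Y (x′ ∷ X′) Y′ len e with ∷-injective e
... | refl , e′ with ++-injective-length X Y X′ Y′ (suc-injective len) e′
...   | refl , refl = refl , refl

AllPairs-++⁻ : ∀ {R : ℕ → ℕ → Set} xs {ys} → AllPairs R (xs ++ ys) →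
  AllPairs R xs × AllPairs R ys × All (λ x → All (R x) ys) xs
AllPairs-++⁻ []       p       = [] , p , []
AllPairs-++⁻ (x ∷ xs) (a ∷ p) with AllPairs-++⁻ xs p
... | pxs , pys , across = (All.++⁻ˡ xs a ∷ pxs) , pys , (All.++⁻ʳ xs a ∷ across)

AllPairs-resp-⊆ : ∀ {R : ℕ → ℕ → Set} {σ xs : List ℕ} → σ ⊆ xs → AllPairs R xs → AllPairs R σ
AllPairs-resp-⊆ []         []       = []
AllPairs-resp-⊆ (_ ∷ʳ p)   (_ ∷ ap) = AllPairs-resp-⊆ p ap
AllPairs-resp-⊆ (refl ∷ p) (h ∷ ap) = ⊆.All-resp-⊆ p h ∷ AllPairs-resp-⊆ p ap

AllPairs-reverse : ∀ {R : ℕ → ℕ → Set} {xs} → AllPairs R xs → AllPairs (flip R) (reverse xs)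
AllPairs-reverse {xs = []}     []           = []
AllPairs-reverse {xs = x ∷ xs} (x-xs ∷ pxs) = subst (AllPairs _) (sym (unfold-reverse x xs))
  (AllPairsₚ.++⁺ (AllPairs-reverse pxs) ([] ∷ []) (All.map (_∷ []) (All-resp-↭ (↭-sym (↭-reverse xs)) x-xs)))

Unique-++-∷ʳ⁻ : ∀ u {m} → Unique (u ++ m ∷ []) → m ∉ u
Unique-++-∷ʳ⁻ u U m∈u = All.lookup (All.lookup (proj₂ (proj₂ (AllPairs-++⁻ u U))) m∈u) (here refl) refl

Unique-resp-↭ : ∀ {xs ys : List ℕ} → xs ↭ ys → Unique ys → Unique xs
Unique-resp-↭ ↭.refl U = U
Unique-resp-↭ (↭.prep x p) (x∉ ∷ U) = All-resp-↭ (↭-sym p) x∉ ∷ Unique-resp-↭ p U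
Unique-resp-↭ (↭.swap x y p) ((y≢x ∷ y∉) ∷ x∉ ∷ U) =
  ((y≢x ∘′ sym) ∷ All-resp-↭ (↭-sym p) x∉) ∷ All-resp-↭ (↭-sym p) y∉ ∷ Unique-resp-↭ p U
Unique-resp-↭ (↭.trans p q) U = Unique-resp-↭ p (Unique-resp-↭ q U)

Below : List ℕ → List ℕ → Set
Below X Y = All (λ x → All (x <_) Y) X

Increasing : List ℕ → Set
Increasing = AllPairs _<_

Decreasing : List ℕ → Set
Decreasing = AllPairs (λ x y → y < x)

Increasing-++⁻ˡ : ∀ X {Y} → Increasing (X ++ Y) → Increasing X
Increasing-++⁻ˡ X = proj₁ ∘′ AllPairs-++⁻ X

Below-++⁻ˡ : ∀ {D} X {Y} → Below D (X ++ Y) → Below D X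
Below-++⁻ˡ X = All.map (All.++⁻ˡ X)

increasing-↭⇒≡ : ∀ {xs ys} → Increasing xs → Increasing ys → xs ↭ ys → xs ≡ ys
increasing-↭⇒≡ {[]}     {[]}     _ _ _ = refl
increasing-↭⇒≡ {[]}     {_ ∷ _}  _ _ p with ↭-length p
... | ()
increasing-↭⇒≡ {_ ∷ _}  {[]}     _ _ p with ↭-length p
... | ()
increasing-↭⇒≡ {x ∷ xs} {y ∷ ys} (x<xs ∷ incxs) (y<ys ∷ incys) p
  with ∈-resp-↭ p (here refl) | ∈-resp-↭ (↭-sym p) (here refl)
... | here refl | _         = cong (x ∷_) (increasing-↭⇒≡ incxs incys (drop-∷ p))
... | there _   | here refl = cong (y ∷_) (increasing-↭⇒≡ incxs incys (drop-∷ p))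
... | there x∈ys | there y∈xs = ⊥-elim (<-asym (All.lookup y<ys x∈ys) (All.lookup x<xs y∈xs))

⊆-split : ∀ {σ : List ℕ} u {v} → σ ⊆ u ++ v → ∃₂ λ σ₁ σ₂ → σ ≡ σ₁ ++ σ₂ × σ₁ ⊆ u × σ₂ ⊆ v
⊆-split []      p        = [] , _ , refl , [] , p
⊆-split (y ∷ u) (.y ∷ʳ p) with ⊆-split u p
... | σ₁ , σ₂ , refl , p₁ , p₂ = σ₁ , σ₂ , refl , y ∷ʳ p₁ , p₂
⊆-split (y ∷ u) (refl ∷ p) with ⊆-split u p
... | σ₁ , σ₂ , refl , p₁ , p₂ = y ∷ σ₁ , σ₂ , refl , refl ∷ p₁ , p₂

Below-⊆ : ∀ {u v a c σ₁ σ₂} → Below u v → (a ∷ σ₁) ⊆ u → σ₂ ⊆ v → c ∈ σ₂ → a < c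
Below-⊆ u<v p₁ p₂ c∈ = All.lookup (All.lookup u<v (⊆-lookup p₁ (here refl))) (⊆-lookup p₂ c∈)

-- The stack-sorting map

∈⇒≤maxL : ∀ {x xs} → x ∈ xs → x ≤ maxL xs
∈⇒≤maxL {xs = y ∷ ys} (here refl) = m≤m⊔n y _
∈⇒≤maxL {xs = y ∷ ys} (there p)   = ≤-trans (∈⇒≤maxL p) (m≤n⊔m y _)

maxL-lub : ∀ {b xs} → All (_≤ b) xs → maxL xs ≤ b
maxL-lub []       = z≤n
maxL-lub (p ∷ ps) = ⊔-lub p (maxL-lub ps)

maxL-∈ : ∀ x xs → maxL (x ∷ xs) ∈ x ∷ xs
maxL-∈ x []       = here (⊔-identityʳ x)
maxL-∈ x (y ∷ ys) with ⊔-sel x (maxL (y ∷ ys))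
... | inj₁ e = here e
... | inj₂ e = there (subst (_∈ y ∷ ys) (sym e) (maxL-∈ y ys))

≤∧∉⇒< : ∀ {m} xs → All (_≤ m) xs → m ∉ xs → All (_< m) xs
≤∧∉⇒< []       []       _  = []
≤∧∉⇒< (x ∷ xs) (p ∷ ps) m∉ = ≤∧≢⇒< p (λ e → m∉ (here (sym e))) ∷ ≤∧∉⇒< xs ps (m∉ ∘′ there)

<⇒∉ : ∀ {m} {xs} → All (_< m) xs → m ∉ xs
<⇒∉ a m∈ = <-irrefl refl (All.lookup a m∈)

maxL-++-∷ : ∀ {m} X Y → All (_< m) X → All (_≤ m) Y → maxL (X ++ m ∷ Y) ≡ m
maxL-++-∷ X Y X<m Y≤m =
  ≤-antisym (maxL-lub (All.++⁺ (All.map <⇒≤ X<m) (≤-refl ∷ Y≤m))) (∈⇒≤maxL (∈-++⁺ʳ X (here refl)))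

splitAt-++-∷ : ∀ {m} X Y → m ∉ X → splitAt m (X ++ m ∷ Y) ≡ (X , Y)
splitAt-++-∷ {m} [] Y _ with m ≟ m
... | yes _ = refl
... | no m≢m = ⊥-elim (m≢m refl)
splitAt-++-∷ {m} (x ∷ X) Y m∉ with x ≟ m
... | yes x≡m = ⊥-elim (m∉ (here (sym x≡m)))
... | no _ rewrite splitAt-++-∷ X Y (λ p → m∉ (there p)) = refl

splitAt-∈ : ∀ {m w} → m ∈ w →
  w ≡ Split.left (splitAt m w) ++ m ∷ Split.right (splitAt m w) × m ∉ Split.left (splitAt m w)
splitAt-∈ {m} {x ∷ xs} p with x ≟ m
... | yes refl = refl , λ ()
splitAt-∈ {m} {x ∷ xs} (here e)  | no x≢m = ⊥-elim (x≢m (sym e))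
splitAt-∈ {m} {x ∷ xs} (there p) | no x≢m with splitAt m xs | splitAt-∈ {m} {xs} p
... | L , R | e , m∉ = cong (x ∷_) e , λ { (here e′) → x≢m (sym e′) ; (there q) → m∉ q }

sFuel-++-∷ : ∀ f {m} X Y → All (_< m) X → All (_≤ m) Y →
  sFuel (suc f) (X ++ m ∷ Y) ≡ sFuel f X ++ sFuel f Y ++ m ∷ []
sFuel-++-∷ f {m} [] Y X<m Y≤m
  rewrite maxL-++-∷ [] Y X<m Y≤m | splitAt-++-∷ [] Y (<⇒∉ X<m) = refl
sFuel-++-∷ f {m} (x ∷ X) Y X<m Y≤m
  rewrite maxL-++-∷ (x ∷ X) Y X<m Y≤m | splitAt-++-∷ (x ∷ X) Y (<⇒∉ X<m) = refl

MaxSplit : List ℕ → Set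
MaxSplit w = Σ (List ℕ) λ L → Σ ℕ λ m → Σ (List ℕ) λ R →
  w ≡ L ++ m ∷ R × All (_< m) L × All (_≤ m) R

maxSplit : ∀ x xs → MaxSplit (x ∷ xs)
maxSplit x xs = L , m , R , w≡ , ≤∧∉⇒< L (All.++⁻ˡ L w≤m) m∉L , All.tail (All.++⁻ʳ L w≤m)
  where
  m = maxL (x ∷ xs)
  L = Split.left (splitAt m (x ∷ xs))
  R = Split.right (splitAt m (x ∷ xs))
  w≡ = proj₁ (splitAt-∈ (maxL-∈ x xs))
  m∉L = proj₂ (splitAt-∈ (maxL-∈ x xs))
  w≤m : All (_≤ m) (L ++ m ∷ R)
  w≤m = subst (All (_≤ m)) w≡ (All.tabulate ∈⇒≤maxL)

sFuel-stable : ∀ f g w → length w ≤ f → length w ≤ g → sFuel f w ≡ sFuel g w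
sFuel-stable _       _       []       _  _  = refl
sFuel-stable (suc f) (suc g) (x ∷ xs) lf lg with maxSplit x xs
... | L , m , R , w≡ , L<m , R≤m = begin
  sFuel (suc f) (x ∷ xs)           ≡⟨ cong (sFuel (suc f)) w≡ ⟩
  sFuel (suc f) (L ++ m ∷ R)       ≡⟨ sFuel-++-∷ f L R L<m R≤m ⟩
  sFuel f L ++ sFuel f R ++ m ∷ [] ≡⟨ cong₂ (λ u v → u ++ v ++ m ∷ [])
                                              (stable L (length-++-∷ˡ L R)) (stable R (length-++-∷ʳ L R)) ⟩
  sFuel g L ++ sFuel g R ++ m ∷ [] ≡⟨ sFuel-++-∷ g L R L<m R≤m ⟨
  sFuel (suc g) (L ++ m ∷ R)       ≡⟨ cong (sFuel (suc g)) w≡ ⟨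
  sFuel (suc g) (x ∷ xs)           ∎
  where
  open ≡-Reasoning
  stable : ∀ V → length V < length (L ++ m ∷ R) → sFuel f V ≡ sFuel g V
  stable V V< = sFuel-stable f g V (shorter lf) (shorter lg)
    where
    shorter : ∀ {h} → length (x ∷ xs) ≤ suc h → length V ≤ h
    shorter le = ≤-pred (≤-trans V< (subst (_≤ _) (cong length w≡) le))

s-++-∷ : ∀ {m} X Y → All (_< m) X → All (_≤ m) Y → s (X ++ m ∷ Y) ≡ s X ++ s Y ++ m ∷ []
s-++-∷ {m} X Y X<m Y≤m = begin
  sFuel (length (X ++ m ∷ Y)) (X ++ m ∷ Y)          ≡⟨ cong (λ f → sFuel f (X ++ m ∷ Y)) (length-++-sucʳ X m Y) ⟩
  sFuel (suc (length (X ++ Y))) (X ++ m ∷ Y)        ≡⟨ sFuel-++-∷ (length (X ++ Y)) X Y X<m Y≤m ⟩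
  sFuel (length (X ++ Y)) X ++ sFuel (length (X ++ Y)) Y ++ m ∷ []
    ≡⟨ cong₂ (λ u v → u ++ v ++ m ∷ []) (sFuel-stable _ _ X (length-++-≤ˡ X) ≤-refl)
                                         (sFuel-stable _ _ Y (length-++-≤ʳ Y {X}) ≤-refl) ⟩
  s X ++ s Y ++ m ∷ []                               ∎
  where open ≡-Reasoning

s-↭ : ∀ w → s w ↭ w
s-↭ w = go w (length-wellFounded w)
  where
  go : ∀ w → Acc (_<_ on length) w → s w ↭ w
  go []       _        = ↭-refl
  go (x ∷ xs) (acc rs) with maxSplit x xs
  ... | L , m , R , w≡ , L<m , R≤m = subst (λ v → s v ↭ v) (sym w≡) (begin
    s (L ++ m ∷ R)       ≡⟨ s-++-∷ L R L<m R≤m ⟩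
    s L ++ s R ++ m ∷ [] ↭⟨ ↭-++⁺ (go L (rs (shorter L (length-++-∷ˡ L R))))
                                  (↭-++⁺ (go R (rs (shorter R (length-++-∷ʳ L R)))) ↭-refl) ⟩
    L ++ R ++ m ∷ []     ↭⟨ ++⁺ˡ L (++-comm R (m ∷ [])) ⟩
    L ++ m ∷ R           ∎)
    where
    open PermutationReasoning
    shorter : ∀ V → length V < length (L ++ m ∷ R) → length V < length (x ∷ xs)
    shorter V = subst (length V <_) (cong length (sym w≡))

s-length : ∀ τ → length (s τ) ≡ length τ
s-length τ = ↭-length (s-↭ τ)

All-s⁻ : ∀ {P : ℕ → Set} τ → All P (s τ) → All P τ
All-s⁻ τ = All-resp-↭ (s-↭ τ)

All-s⁺ : ∀ {P : ℕ → Set} τ → All P τ → All P (s τ)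
All-s⁺ τ = All-resp-↭ (↭-sym (s-↭ τ))

s-empty : ∀ τ → s τ ≡ [] → τ ≡ []
s-empty []      _  = refl
s-empty (x ∷ xs) e with trans (sym (s-length (x ∷ xs))) (cong length e)
... | ()

s-singleton : ∀ x → s (x ∷ []) ≡ x ∷ []
s-singleton x = s-++-∷ [] [] [] []

s-singleton⁻ : ∀ τ x → s τ ≡ x ∷ [] → τ ≡ x ∷ []
s-singleton⁻ (y ∷ [])    x e = trans (sym (s-singleton y)) e
s-singleton⁻ []          x ()
s-singleton⁻ (y ∷ z ∷ τ) x e with trans (sym (s-length (y ∷ z ∷ τ))) (cong length e)
... | ()

s-ascent : ∀ {x y} → x < y → s (x ∷ y ∷ []) ≡ x ∷ y ∷ []
s-ascent {x} x<y = trans (s-++-∷ (x ∷ []) [] (x<y ∷ []) []) (cong (_++ _ ∷ []) (s-singleton x))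

s-inversion : ∀ τ {u z} → s τ ≡ u ++ z ∷ [] →
  ∃₂ λ L R → τ ≡ L ++ z ∷ R × All (_< z) L × All (_≤ z) R × s L ++ s R ≡ u
s-inversion [] {[]}    ()
s-inversion [] {_ ∷ _} ()
s-inversion (x ∷ xs) {u} e with maxSplit x xs
... | L , m , R , w≡ , L<m , R≤m with ∷ʳ-injective (s L ++ s R) u sτ≡
  where
  sτ≡ : (s L ++ s R) ++ m ∷ [] ≡ u ++ _ ∷ []
  sτ≡ = trans (++-assoc (s L) (s R) (m ∷ [])) (trans (sym (s-++-∷ L R L<m R≤m)) (trans (cong s (sym w≡)) e))
... | sLR≡u , refl = L , R , w≡ , L<m , R≤m , sLR≡u

s-last-isMax : ∀ τ {u z} → s τ ≡ u ++ z ∷ [] → All (_≤ z) u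
s-last-isMax τ e with s-inversion τ e
... | L , R , _ , L<z , R≤z , refl = All.++⁺ (All-s⁺ L (All.map <⇒≤ L<z)) (All-s⁺ R R≤z)

s-last-isMax-∈ : ∀ τ {u x a} → s τ ≡ u ++ a ∷ [] → x ∈ u → a < x → ⊥
s-last-isMax-∈ τ e x∈u a<x = <⇒≱ a<x (All.lookup (s-last-isMax τ e) x∈u)

s-++ : ∀ X Y → Below X Y → s (X ++ Y) ≡ s X ++ s Y
s-++ X Y = go Y (length-wellFounded Y)
  where
  open ≡-Reasoning
  go : ∀ Y → Acc (_<_ on length) Y → Below X Y → s (X ++ Y) ≡ s X ++ s Y
  go []       _        _   rewrite ++-identityʳ X = sym (++-identityʳ (s X))
  go (y ∷ ys) (acc rs) X<Y with maxSplit y ys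
  ... | L , m , R , w≡ , L<m , R≤m = begin
    s (X ++ y ∷ ys)                ≡⟨ cong (λ v → s (X ++ v)) w≡ ⟩
    s (X ++ L ++ m ∷ R)            ≡⟨ cong s (++-assoc X L (m ∷ R)) ⟨
    s ((X ++ L) ++ m ∷ R)          ≡⟨ s-++-∷ (X ++ L) R (All.++⁺ X<m L<m) R≤m ⟩
    s (X ++ L) ++ s R ++ m ∷ []    ≡⟨ cong (_++ s R ++ m ∷ []) (go L (rs L-shorter) (All.map (All.++⁻ˡ L ∘′ on-split) X<Y)) ⟩
    (s X ++ s L) ++ s R ++ m ∷ []  ≡⟨ ++-assoc (s X) (s L) _ ⟩
    s X ++ s L ++ s R ++ m ∷ []    ≡⟨ cong (s X ++_) (s-++-∷ L R L<m R≤m) ⟨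
    s X ++ s (L ++ m ∷ R)          ≡⟨ cong (λ v → s X ++ s v) w≡ ⟨
    s X ++ s (y ∷ ys)              ∎
    where
    on-split : ∀ {P : ℕ → Set} → All P (y ∷ ys) → All P (L ++ m ∷ R)
    on-split = subst (All _) w≡
    X<m : All (_< m) X
    X<m = All.map (λ x<Y → All.lookup (on-split x<Y) (∈-++⁺ʳ L (here refl))) X<Y
    L-shorter : length L < length (y ∷ ys)
    L-shorter = subst (length L <_) (cong length (sym w≡)) (length-++-∷ˡ L R)

UniquePreimage : List ℕ → Set
UniquePreimage w = Σ (List ℕ) λ σ → s σ ≡ w × (∀ τ → s τ ≡ w → τ ≡ σ)

-- The preimage of u ++ m ∷ [] is X ++ m ∷ Y for any factorisation u = s X ++ s Y,
-- so there is only one such factorisation.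
preimage-factorisation-unique : ∀ {u m} → UniquePreimage (u ++ m ∷ []) → All (_< m) u →
  ∀ {X Y X′ Y′} → s X ++ s Y ≡ u → s X′ ++ s Y′ ≡ u → X ≡ X′
preimage-factorisation-unique {u} {m} (σ , _ , unique) u<m {X} {Y} {X′} {Y′} e e′ =
  ++-∷-injectiveˡ X X′ (<⇒∉ (proj₁ X,Y<m)) (<⇒∉ (proj₁ X′,Y′<m))
    (trans (unique _ (glued X Y e)) (sym (unique _ (glued X′ Y′ e′))))
  where
  parts<m : ∀ X Y → s X ++ s Y ≡ u → All (_< m) X × All (_< m) Y
  parts<m X Y refl = All-s⁻ X (All.++⁻ˡ (s X) u<m) , All-s⁻ Y (All.++⁻ʳ (s X) u<m)
  X,Y<m = parts<m X Y e
  X′,Y′<m = parts<m X′ Y′ e′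
  glued : ∀ X Y → s X ++ s Y ≡ u → s (X ++ m ∷ Y) ≡ u ++ m ∷ []
  glued X Y e with parts<m X Y e
  ... | X<m , Y<m = trans (s-++-∷ X Y X<m (All.map <⇒≤ Y<m)) (trans (sym (++-assoc (s X) (s Y) _)) (cong (_++ m ∷ []) e))

below-not-uniquely-sorted : ∀ {m} X Y → UniquePreimage (s X ++ s Y ++ m ∷ []) → All (_< m) (s X ++ s Y) →
  Below (s X) (s Y) → s Y ≢ [] → ⊥
below-not-uniquely-sorted {m} X Y us XY<m X<Y sY≢[] =
  sY≢[] (cong s (++-identityʳ-unique X X≡XY))
  where
  X≡XY : X ≡ X ++ Y
  X≡XY = preimage-factorisation-unique (subst UniquePreimage (sym (++-assoc (s X) (s Y) (m ∷ []))) us) XY<m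
           {Y = Y} {Y′ = []} refl (trans (++-identityʳ _) (s-++ X Y (All-s⁻ X (All.map (All-s⁻ Y) X<Y))))

record UniqueSplit (A B : List ℕ) (m : ℕ) : Set where
  field
    whole-preimage : UniquePreimage (A ++ B ++ m ∷ [])
    whole-unique   : Unique (A ++ B ++ m ∷ [])
    A<m            : All (_< m) A
    B<m            : All (_< m) B
    A-preimage     : UniquePreimage A
    B-preimage     : UniquePreimage B

-- The last entry z of w is the maximum of a preimage L ++ z ∷ R, and w = s L ++ s R ++ z ∷ [].
-- If L (resp. R) were empty, R ++ z ∷ [] (resp. z ∷ L) would be a second preimage.
uniquePreimage-split : ∀ u {z} → UniquePreimage (u ++ z ∷ []) → Unique (u ++ z ∷ []) →
  u ≡ [] ⊎ ∃₂ λ A B → u ≡ A ++ B × A ≢ [] × B ≢ [] × UniqueSplit A B z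
uniquePreimage-split u {z} us@(σ , sσ , unique) U with s-inversion σ sσ
... | L , R , σ≡ , _ , _ , sLR≡u = by-emptiness L R refl refl
  where
  u<z : All (_< z) u
  u<z = ≤∧∉⇒< u (s-last-isMax σ sσ) (Unique-++-∷ʳ⁻ u U)
  sL<z : All (_< z) (s L)
  sL<z = All.++⁻ˡ (s L) (subst (All _) (sym sLR≡u) u<z)
  sR<z : All (_< z) (s R)
  sR<z = All.++⁻ʳ (s L) (subst (All _) (sym sLR≡u) u<z)
  R<z = All-s⁻ R sR<z
  w≡ : u ++ z ∷ [] ≡ s L ++ s R ++ z ∷ []
  w≡ = trans (cong (_++ z ∷ []) (sym sLR≡u)) (++-assoc (s L) (s R) (z ∷ []))
  preimage : ∀ X Y → All (_< z) (s X) → All (_< z) (s Y) → s X ++ s Y ≡ u → X ++ z ∷ Y ≡ L ++ z ∷ R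
  preimage X Y X<z Y<z e = trans (unique _ (trans (s-++-∷ X Y (All-s⁻ X X<z) (All.map <⇒≤ (All-s⁻ Y Y<z)))
                                                 (trans (sym (++-assoc (s X) (s Y) _)) (cong (_++ z ∷ []) e)))) σ≡
  L-unique : ∀ τ → s τ ≡ s L → τ ≡ L
  L-unique τ e = ++-cancelʳ (z ∷ R) τ L
    (preimage τ R (subst (All _) (sym e) sL<z) sR<z (trans (cong (_++ s R) e) sLR≡u))
  R-unique : ∀ τ → s τ ≡ s R → τ ≡ R
  R-unique τ e = ∷-injectiveʳ (++-cancelˡ L (z ∷ τ) (z ∷ R)
    (preimage L τ sL<z (subst (All _) (sym e) sR<z) (trans (cong (s L ++_) e) sLR≡u)))
  by-emptiness : ∀ L′ R′ → L′ ≡ L → R′ ≡ R →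
    u ≡ [] ⊎ ∃₂ λ A B → u ≡ A ++ B × A ≢ [] × B ≢ [] × UniqueSplit A B z
  by-emptiness [] [] refl refl = inj₁ (sym sLR≡u)
  by-emptiness [] (_ ∷ _) refl refl =
    ⊥-elim (∷≢[] (∷≡∷ʳ⇒[] R (<⇒∉ R<z) (sym (preimage R [] sR<z [] (trans (++-identityʳ (s R)) sLR≡u)))))
  by-emptiness (_ ∷ _) [] refl refl =
    ⊥-elim (∷≢[] (∷≡∷ʳ⇒[] L (<⇒∉ (All-s⁻ L sL<z))
                              (preimage [] L [] sL<z (trans (sym (++-identityʳ (s L))) sLR≡u))))
  by-emptiness (_ ∷ _) (_ ∷ _) refl refl =
    inj₂ (s L , s R , sym sLR≡u , ∷≢[] ∘′ s-empty L , ∷≢[] ∘′ s-empty R , record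
    { whole-preimage = subst UniquePreimage w≡ us
    ; whole-unique   = subst Unique w≡ U
    ; A<m = sL<z ; B<m = sR<z
    ; A-preimage = L , refl , L-unique
    ; B-preimage = R , refl , R-unique })

module _ {A B m} (split : UniqueSplit A B m) where
  open UniqueSplit split

  ≶-across : ∀ {x y} → x ∈ A → y ∈ B → x < y ⊎ y < x
  ≶-across {x} {y} x∈A y∈B with <-cmp x y
  ... | tri< x<y _ _ = inj₁ x<y
  ... | tri> _ _ y<x = inj₂ y<x
  ... | tri≈ _ refl _ =
    ⊥-elim (All.lookup (All.lookup (proj₂ (proj₂ (AllPairs-++⁻ A whole-unique))) x∈A) (∈-++⁺ˡ y∈B) refl)

  ¬Below : B ≢ [] → Below A B → ⊥
  ¬Below B≢[] A<B with A-preimage | B-preimage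
  ... | X , refl , _ | Y , refl , _ = below-not-uniquely-sorted X Y whole-preimage (All.++⁺ A<m B<m) A<B B≢[]

  ⊆-glue : ∀ {as bs} → as ⊆ A → bs ⊆ B → as ++ bs ⊆ A ++ B ++ m ∷ []
  ⊆-glue as⊆A bs⊆B = ⊆.++⁺ as⊆A (⊆.++⁺ʳ (m ∷ []) bs⊆B)

oneTo : ℕ → List ℕ
oneTo n = map suc (upTo n)

oneTo-∷ʳ : ∀ n → oneTo (suc n) ≡ oneTo n ++ suc n ∷ []
oneTo-∷ʳ n = trans (cong (map suc) (sym (upTo-∷ʳ n))) (map-++ suc (upTo n) (n ∷ []))

oneTo-< : ∀ n → All (_< suc n) (oneTo n)
oneTo-< zero    = []
oneTo-< (suc n) = subst (All (_< 2 + n)) (sym (oneTo-∷ʳ n))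
  (All.++⁺ (All.map (λ x<n → <-trans x<n (n<1+n _)) (oneTo-< n)) (n<1+n _ ∷ []))

oneTo-increasing : ∀ n → Increasing (oneTo n)
oneTo-increasing zero    = []
oneTo-increasing (suc n) = subst Increasing (sym (oneTo-∷ʳ n))
  (AllPairsₚ.++⁺ (oneTo-increasing n) ([] ∷ []) (All.map (_∷ []) (oneTo-< n)))

oneTo-length : ∀ n → length (oneTo n) ≡ n
oneTo-length n = trans (length-map suc (upTo n)) (length-upTo n)

IsPerm⇒Unique : ∀ {n π} → IsPerm n π → Unique π
IsPerm⇒Unique {n} p = Unique-resp-↭ p (AllPairs.map <⇒≢ (oneTo-increasing n))

UniquePreimage⇒UniquelySorted : ∀ {n π} → IsPerm n π → UniquePreimage π → UniquelySorted n π
UniquePreimage⇒UniquelySorted pπ (σ , refl , unique) = σ , ↭-trans (↭-sym (s-↭ σ)) pπ , refl , λ τ _ → unique τ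

UniquelySorted⇒UniquePreimage : ∀ {n π} → IsPerm n π → UniquelySorted n π → UniquePreimage π
UniquelySorted⇒UniquePreimage pπ (σ , _ , sσ , unique) =
  σ , sσ , λ τ sτ → unique τ (↭-trans (↭-sym (subst (_↭ τ) sτ (s-↭ τ))) pπ) sτ

SameOrder : ℕ → ℕ → ℕ → ℕ → Set
SameOrder x y a b = ((x < y) ⇔ (a < b)) × ((y < x) ⇔ (b < a))

<-sameOrder : ∀ {x y a b} → x < y → a < b → SameOrder x y a b
<-sameOrder x<y a<b =
  mk⇔ (λ _ → a<b) (λ _ → x<y) , mk⇔ (λ y<x → ⊥-elim (<-asym x<y y<x)) (λ b<a → ⊥-elim (<-asym a<b b<a))

>-sameOrder : ∀ {x y a b} → y < x → b < a → SameOrder x y a b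
>-sameOrder y<x b<a =
  mk⇔ (λ x<y → ⊥-elim (<-asym x<y y<x)) (λ a<b → ⊥-elim (<-asym a<b b<a)) , mk⇔ (λ _ → b<a) (λ _ → y<x)

ordIso₃ : ∀ {x y z a b c} → SameOrder x y a b → SameOrder x z a c → SameOrder y z b c →
  OrdIso (x ∷ y ∷ z ∷ []) (a ∷ b ∷ c ∷ [])
ordIso₃ xy xz yz = cons (xy ∷ xz ∷ []) (cons (yz ∷ []) (cons [] []))

1<2 : 1 < 2
1<2 = s≤s (s≤s z≤n)

1<3 : 1 < 3
1<3 = s≤s (s≤s z≤n)

2<3 : 2 < 3
2<3 = s≤s (s≤s (s≤s z≤n))

module _ {w : List ℕ} {x y z : ℕ} (occurrence : (x ∷ y ∷ z ∷ []) ⊆ w) where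

  contains-231 : z < x → x < y → Contains w p231
  contains-231 z<x x<y = _ , occurrence , ordIso₃ (<-sameOrder x<y 2<3) (>-sameOrder z<x 1<2) (>-sameOrder (<-trans z<x x<y) 1<3)

  contains-321 : z < y → y < x → Contains w p321
  contains-321 z<y y<x = _ , occurrence , ordIso₃ (>-sameOrder y<x 2<3) (>-sameOrder (<-trans z<y y<x) 1<3) (>-sameOrder z<y 1<2)

  contains-312 : y < z → z < x → Contains w p312
  contains-312 y<z z<x = _ , occurrence , ordIso₃ (>-sameOrder (<-trans y<z z<x) 1<3) (>-sameOrder z<x 2<3) (<-sameOrder y<z 1<2)

  contains-132 : x < z → z < y → Contains w p132
  contains-132 x<z z<y = _ , occurrence , ordIso₃ (<-sameOrder (<-trans x<z z<y) 1<3) (<-sameOrder x<z 1<2) (>-sameOrder z<y 2<3)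

avoids-⊆ : ∀ {u w τ} → u ⊆ w → Avoids w τ → Avoids u τ
avoids-⊆ u⊆w av (σ , σ⊆u , iso) = av (σ , ⊆-trans σ⊆u u⊆w , iso)

ordIso-length : ∀ {σ τ} → OrdIso σ τ → length σ ≡ length τ
ordIso-length []         = refl
ordIso-length (cons _ i) = cong suc (ordIso-length i)

shorter-avoids : ∀ u τ → length u < length τ → Avoids u τ
shorter-avoids u τ u<τ (σ , σ⊆u , iso) =
  <⇒≱ u<τ (subst (_≤ length u) (ordIso-length iso) (⊆.length-mono-≤ σ⊆u))

Below-++-avoids : ∀ {t₁ t₂ t₃} u v → t₃ < t₁ → Below u v →
  Avoids u (t₁ ∷ t₂ ∷ t₃ ∷ []) → Avoids v (t₁ ∷ t₂ ∷ t₃ ∷ []) → Avoids (u ++ v) (t₁ ∷ t₂ ∷ t₃ ∷ [])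
Below-++-avoids u v t₃<t₁ u<v avu avv (_ , σ⊆ , iso@(cons (_ ∷ first-last ∷ []) _)) with ⊆-split u σ⊆
... | []             , _          , refl , _  , p₂ = avv (_ , p₂ , iso)
... | _ ∷ []         , _ ∷ _ ∷ [] , refl , p₁ , p₂ = <-asym c<a (Below-⊆ u<v p₁ p₂ (there (here refl)))
  where c<a = Equivalence.from (proj₂ first-last) t₃<t₁
... | _ ∷ _ ∷ []     , _ ∷ []     , refl , p₁ , p₂ = <-asym c<a (Below-⊆ u<v p₁ p₂ (here refl))
  where c<a = Equivalence.from (proj₂ first-last) t₃<t₁
... | _ ∷ _ ∷ _ ∷ [] , []         , refl , p₁ , _  = avu (_ , p₁ , iso)

module _ (Shape : List ℕ → Set) (τs : List (List ℕ))
         (singleton : ∀ m → Shape (m ∷ []))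
         (glue : ∀ {A B m} → UniqueSplit A B m → All (Avoids (A ++ B ++ m ∷ [])) τs →
                 Shape A → Shape B → Shape (A ++ B ++ m ∷ []))
  where

  uniquelySorted-induction : ∀ w → UniquePreimage w → Unique w → w ≢ [] → All (Avoids w) τs → Shape w
  uniquelySorted-induction w = go w (length-wellFounded w)
    where
    go : ∀ w → Acc (_<_ on length) w → UniquePreimage w → Unique w → w ≢ [] → All (Avoids w) τs → Shape w
    go w rec us U w≢[] av with initLast w
    go _ _ _ _ w≢[] _ | [] = ⊥-elim (w≢[] refl)
    go _ (acc rs) us U _ av | u ∷ʳ′ z with uniquePreimage-split u us U
    ... | inj₁ refl = singleton z
    ... | inj₂ (A , B , refl , A≢[] , B≢[] , split) =
      subst Shape (sym w≡)
        (glue split av′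
          (go A (rs A-shorter) (UniqueSplit.A-preimage split) (proj₁ AB-unique) A≢[] (All.map (avoids-⊆ A⊆w) av′))
          (go B (rs B-shorter) (UniqueSplit.B-preimage split) (proj₂ AB-unique) B≢[] (All.map (avoids-⊆ B⊆w) av′)))
      where
      w≡ = ++-assoc A B (z ∷ [])
      av′ = subst (λ v → All (Avoids v) τs) w≡ av
      AB-unique : Unique A × Unique B
      AB-unique with AllPairs-++⁻ A (UniqueSplit.whole-unique split)
      ... | A-unique , Bz-unique , _ = A-unique , proj₁ (AllPairs-++⁻ B Bz-unique)
      A⊆w : A ⊆ A ++ B ++ z ∷ []
      A⊆w = ⊆.++⁺ʳ (B ++ z ∷ []) ⊆-refl
      B⊆w : B ⊆ A ++ B ++ z ∷ []
      B⊆w = ⊆.++⁺ˡ A (⊆.++⁺ʳ (z ∷ []) ⊆-refl)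
      u-shorter : length (A ++ B) < length ((A ++ B) ++ z ∷ [])
      u-shorter = length-++-∷ˡ (A ++ B) []
      A-shorter : length A < length ((A ++ B) ++ z ∷ [])
      A-shorter = ≤-<-trans (length-++-≤ˡ A) u-shorter
      B-shorter : length B < length ((A ++ B) ++ z ∷ [])
      B-shorter = ≤-<-trans (length-++-≤ʳ B {A}) u-shorter

  InU⇒Shape : ∀ n π → InU (suc n) τs π → Shape π
  InU⇒Shape n π (pπ , us , avs) =
    uniquelySorted-induction π (UniquelySorted⇒UniquePreimage pπ us) (IsPerm⇒Unique pπ) π≢[] avs
    where
    π≢[] : π ≢ []
    π≢[] refl with ↭-length pπ
    ... | ()

-- Layered words

-- The pairs are listed from the right; a pair (p , q) contributes the adjacent entries q p.
Pairs : Set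
Pairs = List (ℕ × ℕ)

pairEntries : Pairs → List ℕ
pairEntries []            = []
pairEntries ((p , q) ∷ r) = pairEntries r ++ p ∷ q ∷ []

layered : Pairs → ℕ → List ℕ
layered []            z = z ∷ []
layered ((p , q) ∷ r) z = layered r q ++ p ∷ z ∷ []

IsLayering : Pairs → ℕ → Set
IsLayering []            z = ⊤
IsLayering ((p , q) ∷ r) z = IsLayering r q × All (_< p) (pairEntries r) × p < q × q < z

Layered : List ℕ → Set
Layered w = Σ Pairs λ ps → Σ ℕ λ z → IsLayering ps z × w ≡ layered ps z

pairEntries-< : ∀ ps {z} → IsLayering ps z → All (_< z) (pairEntries ps)
pairEntries-< []            _                      = []
pairEntries-< ((p , q) ∷ r) (_ , r<p , p<q , q<z) =
  All.++⁺ (All.map (λ x<p → <-trans x<p p<z) r<p) (p<z ∷ q<z ∷ [])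
  where p<z = <-trans p<q q<z

layered-All : ∀ {P : ℕ → Set} ps z → All P (pairEntries ps) → P z → All P (layered ps z)
layered-All []            z _  Pz = Pz ∷ []
layered-All ((p , q) ∷ r) z Pe Pz with All.++⁻ (pairEntries r) Pe
... | Pr , Pp ∷ Pq ∷ [] = All.++⁺ (layered-All r q Pr Pq) (Pp ∷ Pz ∷ [])

layered-≤ : ∀ ps z → IsLayering ps z → All (_≤ z) (layered ps z)
layered-≤ ps z ok = layered-All ps z (All.map <⇒≤ (pairEntries-< ps ok)) ≤-refl

layered-∷ʳ : ∀ ps z → ∃ λ u → layered ps z ≡ u ++ z ∷ []
layered-∷ʳ []            z = [] , refl
layered-∷ʳ ((p , q) ∷ r) z = layered r q ++ p ∷ [] , sym (++-assoc (layered r q) (p ∷ []) (z ∷ []))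

∈-layered : ∀ ps z → z ∈ layered ps z
∈-layered ps z with layered-∷ʳ ps z
... | u , e = subst (z ∈_) (sym e) (∈-++⁺ʳ u (here refl))

layered-↭ : ∀ ps z → layered ps z ↭ pairEntries ps ++ z ∷ []
layered-↭ []            z = ↭-refl
layered-↭ ((p , q) ∷ r) z = begin
  layered r q ++ p ∷ z ∷ []           ↭⟨ ++⁺ʳ (p ∷ z ∷ []) (layered-↭ r q) ⟩
  (pairEntries r ++ q ∷ []) ++ p ∷ z ∷ [] ≡⟨ ++-assoc (pairEntries r) (q ∷ []) (p ∷ z ∷ []) ⟩
  pairEntries r ++ q ∷ p ∷ z ∷ []     ↭⟨ ++⁺ˡ (pairEntries r) (↭-swap q p ↭-refl) ⟩
  pairEntries r ++ p ∷ q ∷ z ∷ []     ≡⟨ ++-assoc (pairEntries r) (p ∷ q ∷ []) (z ∷ []) ⟨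
  (pairEntries r ++ p ∷ q ∷ []) ++ z ∷ [] ∎
  where open PermutationReasoning

-- A preimage of layered r q ++ p z is L ++ z ∷ R with s L ++ s R = layered r q ++ p;
-- since q > p precedes p, the only possibility is R = p and s L = layered r q.
layered-preimage : ∀ ps z → IsLayering ps z → UniquePreimage (layered ps z)
layered-preimage []            z _ = z ∷ [] , s-singleton z , λ τ e → s-singleton⁻ τ z e
layered-preimage ((p , q) ∷ r) z (ok , r<p , p<q , q<z) with layered-preimage r q ok
... | σ , sσ , unique = σ ++ z ∷ p ∷ [] , sσ′ , unique′
  where
  σ<z : All (_< z) σ
  σ<z = All-s⁻ σ (subst (All _) (sym sσ) (layered-All r q (All.map (λ x<q → <-trans x<q q<z) (pairEntries-< r ok)) q<z))
  sσ′ : s (σ ++ z ∷ p ∷ []) ≡ layered r q ++ p ∷ z ∷ []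
  sσ′ = trans (s-++-∷ σ (p ∷ []) σ<z (<⇒≤ (<-trans p<q q<z) ∷ []))
              (cong₂ (λ a b → a ++ b ++ z ∷ []) sσ (s-singleton p))
  u = proj₁ (layered-∷ʳ r q)
  rq≡ = proj₂ (layered-∷ʳ r q)
  unique′ : ∀ τ → s τ ≡ layered r q ++ p ∷ z ∷ [] → τ ≡ σ ++ z ∷ p ∷ []
  unique′ τ e with s-inversion τ (trans e (sym (++-assoc (layered r q) (p ∷ []) (z ∷ []))))
  ... | L , R , refl , _ , _ , sLR with []-or-∷ʳ (s R)
  ...   | inj₁ sR≡[] = ⊥-elim (s-last-isMax-∈ L sL≡ (∈-layered r q) p<q)
    where sL≡ = trans (sym (++-identityʳ (s L))) (trans (cong (s L ++_) (sym sR≡[])) sLR)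
  ...   | inj₂ (V , y , sR≡) with ++-∷ʳ-injective (s L) (layered r q) (trans (cong (s L ++_) (sym sR≡)) sLR)
  ...     | sLV≡ , refl with []-or-∷ʳ V
  ...       | inj₁ refl =
    cong₂ (λ A B → A ++ z ∷ B) (unique L (trans (sym (++-identityʳ (s L))) sLV≡)) (s-singleton⁻ R y sR≡)
  ...       | inj₂ (V′ , v , refl) with ++-∷ʳ-injective (s L) u (trans sLV≡ rq≡)
  ...         | _ , refl = ⊥-elim (s-last-isMax-∈ R sR≡ (∈-++⁺ʳ V′ (here refl)) p<q)

layered-front : ∀ ps d₁ d₂ z → layered (ps ++ (d₁ , d₂) ∷ []) z ≡ d₂ ∷ d₁ ∷ layered ps z
layered-front []            d₁ d₂ z = refl
layered-front ((p , q) ∷ r) d₁ d₂ z = cong (_++ p ∷ z ∷ []) (layered-front r d₁ d₂ q)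

pairEntries-front : ∀ ps d₁ d₂ → pairEntries (ps ++ (d₁ , d₂) ∷ []) ≡ d₁ ∷ d₂ ∷ pairEntries ps
pairEntries-front []            d₁ d₂ = refl
pairEntries-front ((p , q) ∷ r) d₁ d₂ = cong (_++ p ∷ q ∷ []) (pairEntries-front r d₁ d₂)

IsLayering-front : ∀ ps d₁ d₂ z → IsLayering (ps ++ (d₁ , d₂) ∷ []) z →
  IsLayering ps z × d₁ < d₂ × All (d₂ <_) (layered ps z)
IsLayering-front []            d₁ d₂ z (_ , _ , d₁<d₂ , d₂<z) = tt , d₁<d₂ , d₂<z ∷ []
IsLayering-front ((p , q) ∷ r) d₁ d₂ z (ok , r<p , p<q , q<z) with IsLayering-front r d₁ d₂ q ok
... | ok′ , d₁<d₂ , d₂<rq with subst (All (_< p)) (pairEntries-front r d₁ d₂) r<p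
...   | _ ∷ d₂<p ∷ r′<p =
  (ok′ , r′<p , p<q , q<z) , d₁<d₂ , All.++⁺ d₂<rq (d₂<p ∷ <-trans d₂<p (<-trans p<q q<z) ∷ [])

layered-avoids : ∀ {t₁ t₂ t₃} ps z → IsLayering ps z → t₃ < t₁ → Avoids (layered ps z) (t₁ ∷ t₂ ∷ t₃ ∷ [])
layered-avoids {t₁} {t₂} {t₃} ps z ok t₃<t₁ = go ps (length-wellFounded ps) ok
  where
  go : ∀ ps → Acc (_<_ on length) ps → IsLayering ps z → Avoids (layered ps z) (t₁ ∷ t₂ ∷ t₃ ∷ [])
  go ps rec ok with initLast ps
  go _ _        _  | []              = shorter-avoids (z ∷ []) _ (s≤s (s≤s z≤n))
  go _ (acc rs) ok | ps′ ∷ʳ′ (d₁ , d₂) with IsLayering-front ps′ d₁ d₂ z ok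
  ... | ok′ , d₁<d₂ , d₂<ps′ =
    subst (λ w → Avoids w (t₁ ∷ t₂ ∷ t₃ ∷ [])) (sym (layered-front ps′ d₁ d₂ z))
      (Below-++-avoids (d₂ ∷ d₁ ∷ []) (layered ps′ z) t₃<t₁ (d₂<ps′ ∷ All.map (<-trans d₁<d₂) d₂<ps′ ∷ [])
        (shorter-avoids (d₂ ∷ d₁ ∷ []) _ (s≤s (s≤s (s≤s z≤n))))
        (go ps′ (rs (length-++-∷ˡ ps′ [])) ok′))

pairEntries-increasing : ∀ ps {z} → IsLayering ps z → Increasing (pairEntries ps ++ z ∷ [])
pairEntries-increasing []            _                     = [] ∷ []
pairEntries-increasing ((p , q) ∷ r) {z} (ok , r<p , p<q , q<z) =
  subst Increasing (sym (++-assoc (pairEntries r) (p ∷ q ∷ []) (z ∷ [])))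
    (AllPairsₚ.++⁺ (Increasing-++⁻ˡ (pairEntries r) (pairEntries-increasing r ok))
                   ((p<q ∷ <-trans p<q q<z ∷ []) ∷ (q<z ∷ []) ∷ [] ∷ [])
                   (All.map (λ x<p → x<p ∷ <-trans x<p p<q ∷ <-trans x<p (<-trans p<q q<z) ∷ []) r<p))

pairEntries-injective : ∀ ps ps′ → pairEntries ps ≡ pairEntries ps′ → ps ≡ ps′
pairEntries-injective []            []              _ = refl
pairEntries-injective []            ((p , q) ∷ r)   e = ⊥-elim (∷≢[] (++-conicalʳ (pairEntries r) _ (sym e)))
pairEntries-injective ((p , q) ∷ r) []              e = ⊥-elim (∷≢[] (++-conicalʳ (pairEntries r) _ e))
pairEntries-injective ((p , q) ∷ r) ((p′ , q′) ∷ r′) e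
  with ∷ʳ-injective (pairEntries r ++ p ∷ []) (pairEntries r′ ++ p′ ∷ [])
         (trans (++-assoc (pairEntries r) _ _) (trans e (sym (++-assoc (pairEntries r′) _ _))))
... | e′ , refl with ∷ʳ-injective (pairEntries r) (pairEntries r′) e′
...   | e″ , refl = cong (_ ∷_) (pairEntries-injective r r′ e″)

layered-determined : ∀ {u v} → Layered u → Layered v → u ↭ v → u ≡ v
layered-determined (ps , z , ok , refl) (ps′ , z′ , ok′ , refl) u↭v
  with ∷ʳ-injective (pairEntries ps) (pairEntries ps′)
         (increasing-↭⇒≡ (pairEntries-increasing ps ok) (pairEntries-increasing ps′ ok′)
           (↭-trans (↭-sym (layered-↭ ps z)) (↭-trans u↭v (layered-↭ ps′ z′))))
... | e , refl = cong (λ ps → layered ps z) (pairEntries-injective ps ps′ e)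

layered-singleton : ∀ m → Layered (m ∷ [])
layered-singleton m = [] , m , tt , refl

module _ {psA a B m} (split : UniqueSplit (layered psA a) B m) (okA : IsLayering psA a) where

  a<B⇒⊥ : B ≢ [] → All (a <_) B → ⊥
  a<B⇒⊥ B≢[] a<B = ¬Below split B≢[] (All.map (λ x≤a → All.map (≤-<-trans x≤a) a<B) (layered-≤ psA a okA))

  -- The rightmost layer q p of A must lie below b, unless a forbidden pattern q a b or q p b appears.
  layered-glue-[] : ∀ {b} → B ≡ b ∷ [] → (∀ {p q r} → psA ≡ (p , q) ∷ r → b < q → ⊥) →
    Layered (layered psA a ++ B ++ m ∷ [])
  layered-glue-[] {b} refl b≮q with ≶-across split (∈-layered psA a) (here refl)
  ... | inj₁ a<b = ⊥-elim (a<B⇒⊥ ∷≢[] (a<b ∷ []))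
  ... | inj₂ b<a = (b , a) ∷ psA , m , (okA , psA<b psA refl okA , b<a , a<m) , refl
    where
    a<m = All.lookup (UniqueSplit.A<m split) (∈-layered psA a)
    psA<b : ∀ ps → ps ≡ psA → IsLayering ps a → All (_< b) (pairEntries ps)
    psA<b []            _    _                     = []
    psA<b ((p , q) ∷ r) refl (okr , r<p , p<q , _) with ≶-across split (∈-++⁺ˡ (∈-layered r q)) (here refl)
    ... | inj₁ q<b = pairEntries-< ((p , q) ∷ r) (okr , r<p , p<q , q<b)
    ... | inj₂ b<q = ⊥-elim (b≮q refl b<q)

last-layer-qa-⊆ : ∀ p q r a → (q ∷ a ∷ []) ⊆ layered ((p , q) ∷ r) a
last-layer-qa-⊆ p q r a = ⊆.++⁺ (from∈ (∈-layered r q)) (p ∷ʳ ⊆-refl)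

last-layer-qp-⊆ : ∀ p q r a → (q ∷ p ∷ []) ⊆ layered ((p , q) ∷ r) a
last-layer-qp-⊆ p q r a = ⊆.++⁺ (from∈ (∈-layered r q)) (refl ∷ a ∷ʳ [])

descent-front-231-321 : ∀ {psA a B m d₁ d₂ rest} → UniqueSplit (layered psA a) B m → IsLayering psA a →
  B ≡ d₂ ∷ d₁ ∷ rest → d₁ < d₂ → All (d₂ <_) rest →
  Avoids (layered psA a ++ B ++ m ∷ []) p231 → Avoids (layered psA a ++ B ++ m ∷ []) p321 → ⊥
descent-front-231-321 {psA} {a} split okA refl d₁<d₂ d₂<rest av231 av321
  with ≶-across split (∈-layered psA a) (there (here refl))
... | inj₁ a<d₁ =
  a<B⇒⊥ split okA ∷≢[] (<-trans a<d₁ d₁<d₂ ∷ a<d₁ ∷ All.map (<-trans (<-trans a<d₁ d₁<d₂)) d₂<rest)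
... | inj₂ d₁<a with ≶-across split (∈-layered psA a) (here refl)
...   | inj₁ a<d₂ = av231 (contains-231 (⊆-glue split (from∈ (∈-layered psA a)) (refl ∷ refl ∷ minimum _)) d₁<a a<d₂)
...   | inj₂ d₂<a = av321 (contains-321 (⊆-glue split (from∈ (∈-layered psA a)) (refl ∷ refl ∷ minimum _)) d₁<d₂ d₂<a)

-- An entry of A above d₂ would start a 321 with d₂ d₁; so A < d₂, and then A d₂ | d₁ rest is a
-- second factorisation of A B into images.
descent-front-321 : ∀ {A B m d₁ d₂ rest} → UniqueSplit A B m → B ≡ d₂ ∷ d₁ ∷ rest → d₁ < d₂ → All (d₁ <_) rest →
  UniquePreimage rest → Avoids (A ++ B ++ m ∷ []) p321 → ⊥
descent-front-321 {A} {m = m} {d₁} {d₂} {rest} split refl d₁<d₂ d₁<rest (Y , sY , _) av321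
  with UniqueSplit.A-preimage split | UniqueSplit.B-preimage split
... | X , sX , _ | Z , sZ , _ = ∷≢[] (++-identityʳ-unique X X≡X++d₂)
  where
  A<d₂ : All (_< d₂) A
  A<d₂ = All.tabulate λ {x} x∈A → case ≶-across split x∈A (here refl) of λ where
    (inj₁ x<d₂) → x<d₂
    (inj₂ d₂<x) → ⊥-elim (av321 (contains-321 (⊆-glue split (from∈ x∈A) (refl ∷ refl ∷ minimum _)) d₁<d₂ d₂<x))
  X<d₂ = All-s⁻ X (subst (All _) (sym sX) A<d₂)
  sXd₂ : s (X ++ d₂ ∷ []) ≡ A ++ d₂ ∷ []
  sXd₂ = trans (s-++-∷ X [] X<d₂ []) (cong (_++ d₂ ∷ []) sX)
  sd₁Y : s (d₁ ∷ Y) ≡ d₁ ∷ rest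
  sd₁Y = trans (s-++ (d₁ ∷ []) Y (All-s⁻ Y (subst (All _) (sym sY) d₁<rest) ∷ [])) (cong₂ _++_ (s-singleton d₁) sY)
  X≡X++d₂ : X ≡ X ++ d₂ ∷ []
  X≡X++d₂ = preimage-factorisation-unique
    (subst UniquePreimage (sym (++-assoc A _ (m ∷ []))) (UniqueSplit.whole-preimage split))
    (All.++⁺ (UniqueSplit.A<m split) (UniqueSplit.B<m split))
    {Y = Z} {Y′ = d₁ ∷ Y} (cong₂ _++_ sX sZ) (trans (cong₂ _++_ sXd₂ sd₁Y) (++-assoc A (d₂ ∷ []) _))

layered-glue-231-321 : ∀ {A B m} → UniqueSplit A B m → All (Avoids (A ++ B ++ m ∷ [])) (p231 ∷ p321 ∷ []) →
  Layered A → Layered B → Layered (A ++ B ++ m ∷ [])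
layered-glue-231-321 split (av231 ∷ av321 ∷ []) (psA , a , okA , refl) (psB , b , okB , refl) with initLast psB
... | [] = layered-glue-[] split okA refl λ { {p} {q} {r} refl b<q →
        av231 (contains-231 (⊆-glue split (last-layer-qa-⊆ p q r a) ⊆-refl) b<q (proj₂ (proj₂ (proj₂ okA)))) }
... | ps′ ∷ʳ′ (d₁ , d₂) with IsLayering-front ps′ d₁ d₂ b okB
...   | _ , d₁<d₂ , d₂<ps′ =
  ⊥-elim (descent-front-231-321 split okA (layered-front ps′ d₁ d₂ b) d₁<d₂ d₂<ps′ av231 av321)

layered-glue-312-321 : ∀ {A B m} → UniqueSplit A B m → All (Avoids (A ++ B ++ m ∷ [])) (p312 ∷ p321 ∷ []) →
  Layered A → Layered B → Layered (A ++ B ++ m ∷ [])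
layered-glue-312-321 split (av312 ∷ av321 ∷ []) (psA , a , okA , refl) (psB , b , okB , refl) with initLast psB
... | [] = layered-glue-[] split okA refl λ { {p} {q} {r} refl b<q →
        case ≶-across split (∈-++⁺ʳ (layered r q) (here refl)) (here refl) of λ where
          (inj₁ p<b) → av312 (contains-312 (⊆-glue split (last-layer-qp-⊆ p q r a) ⊆-refl) p<b b<q)
          (inj₂ b<p) → av321 (contains-321 (⊆-glue split (last-layer-qp-⊆ p q r a) ⊆-refl) b<p (proj₁ (proj₂ (proj₂ okA)))) }
... | ps′ ∷ʳ′ (d₁ , d₂) with IsLayering-front ps′ d₁ d₂ b okB
...   | ok′ , d₁<d₂ , d₂<ps′ =
  ⊥-elim (descent-front-321 split (layered-front ps′ d₁ d₂ b) d₁<d₂ (All.map (<-trans d₁<d₂) d₂<ps′)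
                            (layered-preimage ps′ b ok′) av321)

-- Valleys

record IsValley (D I : List ℕ) : Set where
  constructor isValley
  field
    decreasing : Decreasing D
    increasing : Increasing I
    below      : Below D I
    one-longer : length D ≡ suc (length I)

Valley : List ℕ → Set
Valley w = ∃₂ λ D I → IsValley D I × w ≡ D ++ I

decreasing-no-preimage : ∀ τ {D} → Decreasing D → 2 ≤ length D → s τ ≢ D
decreasing-no-preimage τ {d ∷ D′} (d>D′ ∷ _) _ e with []-or-∷ʳ D′
decreasing-no-preimage τ {d ∷ _} _ (s≤s ()) e | inj₁ refl
... | inj₂ (u , l , refl) = <⇒≱ (All.lookup d>D′ (∈-++⁺ʳ u (here refl))) (All.head (s-last-isMax τ e))

-- How the preimage L ++ b ∷ R of D ++ I′ ++ b splits D ++ I′ into s L and s R.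
data ValleyCut (D I′ L R : List ℕ) : Set where
  crossing    : ∀ M → s L ≡ D ++ M → I′ ≡ M ++ s R → ValleyCut D I′ L R
  empty-left  : L ≡ [] → s R ≡ D ++ I′ → ValleyCut D I′ L R
  single-left : ∀ d D′ → D ≡ d ∷ D′ → L ≡ d ∷ [] → s R ≡ D′ ++ I′ → ValleyCut D I′ L R

-- The last entry b is the maximum, and a prefix s L of the decreasing D has length at most one.
valley-inversion : ∀ τ D I′ {b} → Decreasing D → s τ ≡ (D ++ I′) ++ b ∷ [] →
  ∃₂ λ L R → τ ≡ L ++ b ∷ R × ValleyCut D I′ L R
valley-inversion τ D I′ decD e with s-inversion τ e
... | L , R , τ≡ , _ , _ , sLR with ++-split (s L) (s R) D I′ sLR
...   | inj₁ (M , sL≡ , I′≡) = L , R , τ≡ , crossing M sL≡ I′≡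
...   | inj₂ (M , D≡ , sR≡) = L , R , τ≡ , prefix (s L) refl
  where
  prefix : ∀ v → s L ≡ v → ValleyCut D I′ L R
  prefix []          sL≡ =
    empty-left (s-empty L sL≡) (subst (λ D → s R ≡ D ++ I′) (sym (trans D≡ (cong (_++ M) sL≡))) sR≡)
  prefix (x ∷ [])    sL≡ = single-left x M (trans D≡ (cong (_++ M) sL≡)) (s-singleton⁻ L x sL≡) sR≡
  prefix (x ∷ y ∷ v) sL≡ = ⊥-elim (decreasing-no-preimage L (proj₁ (AllPairs-++⁻ (s L) (subst Decreasing D≡ decD)))
                                     (subst (λ v → 2 ≤ length v) (sym sL≡) (s≤s (s≤s z≤n))) refl)

valley-no-preimage : ∀ τ D I → Decreasing D → Increasing I → Below D I → 2 + length I ≤ length D → s τ ≢ D ++ I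
valley-no-preimage τ D I = go I (length-wellFounded I) τ D
  where
  go : ∀ I → Acc (_<_ on length) I → ∀ τ D → Decreasing D → Increasing I → Below D I →
       2 + length I ≤ length D → s τ ≢ D ++ I
  go I rec τ D decD incI D<I long e with []-or-∷ʳ I
  ... | inj₁ refl = decreasing-no-preimage τ decD long (trans e (++-identityʳ D))
  go I (acc rs) τ D decD incI D<I long e | inj₂ (I′ , b , refl)
    with valley-inversion τ D I′ decD (trans e (sym (++-assoc D I′ (b ∷ []))))
  ... | L , R , _ , crossing M sL≡ refl =
    go M (rs (≤-<-trans (length-++-≤ˡ M) I′<I)) L D decD (Increasing-++⁻ˡ M incI′) (Below-++⁻ˡ M D<I′)
       (≤-trans (+-monoʳ-≤ 2 (≤-trans (length-++-≤ˡ M) (<⇒≤ I′<I))) long) sL≡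
    where
    I′<I = length-++-∷ˡ (M ++ s R) []
    incI′ = Increasing-++⁻ˡ (M ++ s R) incI
    D<I′ = Below-++⁻ˡ (M ++ s R) D<I
  ... | L , R , _ , empty-left _ sR≡ =
    go I′ (rs I′<I) R D decD (Increasing-++⁻ˡ I′ incI) (Below-++⁻ˡ I′ D<I) (≤-trans (+-monoʳ-≤ 2 (<⇒≤ I′<I)) long) sR≡
    where I′<I = length-++-∷ˡ I′ []
  ... | L , R , _ , single-left d D′ refl _ sR≡ =
    go I′ (rs (length-++-∷ˡ I′ [])) R D′ (AllPairs.tail decD) (Increasing-++⁻ˡ I′ incI) (All.tail (Below-++⁻ˡ I′ D<I))
       (≤-pred (≤-trans (+-monoʳ-≤ 2 (length-++-∷ˡ I′ [])) long)) sR≡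

valley-preimage : ∀ {D I} → IsValley D I → UniquePreimage (D ++ I)
valley-preimage {D} {I} = go I (length-wellFounded I) D
  where
  go : ∀ I → Acc (_<_ on length) I → ∀ D → IsValley D I → UniquePreimage (D ++ I)
  go I rec D v with []-or-∷ʳ I
  go _ _ (d ∷ []) _ | inj₁ refl = d ∷ [] , s-singleton d , λ τ e → s-singleton⁻ τ d e
  go _ (acc rs) (d ∷ D′) (isValley decD incI D<I lenD) | inj₂ (I′ , b , refl)
    with go I′ (rs (length-++-∷ˡ I′ [])) D′
            (isValley (AllPairs.tail decD) (Increasing-++⁻ˡ I′ incI) (All.tail (Below-++⁻ˡ I′ D<I))
                      (trans (suc-injective lenD) (length-∷ʳ I′)))
  ... | σ′ , sσ′ , unique′ = d ∷ b ∷ σ′ , sσ , unique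
    where
    D′I′<b : All (_< b) (D′ ++ I′)
    D′I′<b = All.++⁺ (All.map (λ x<I → All.lookup x<I (∈-++⁺ʳ I′ (here refl))) (All.tail D<I))
                     (All.map All.head (proj₂ (proj₂ (AllPairs-++⁻ I′ incI))))
    d<b : d < b
    d<b = All.lookup (All.head D<I) (∈-++⁺ʳ I′ (here refl))
    sσ : s (d ∷ b ∷ σ′) ≡ (d ∷ D′) ++ I′ ++ b ∷ []
    sσ = trans (s-++-∷ (d ∷ []) σ′ (d<b ∷ []) (All.map <⇒≤ (All-s⁻ σ′ (subst (All _) (sym sσ′) D′I′<b))))
               (trans (cong₂ (λ u v → u ++ v ++ b ∷ []) (s-singleton d) sσ′) (cong (d ∷_) (++-assoc D′ I′ (b ∷ []))))
    long : ∀ {n} → n ≤ length I′ → 2 + n ≤ length (d ∷ D′)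
    long {n} n≤ = subst (2 + n ≤_) (sym lenD) (s≤s (≤-<-trans n≤ (length-++-∷ˡ I′ [])))
    unique : ∀ τ → s τ ≡ (d ∷ D′) ++ I′ ++ b ∷ [] → τ ≡ d ∷ b ∷ σ′
    unique τ e with valley-inversion τ (d ∷ D′) I′ decD (trans e (sym (++-assoc (d ∷ D′) I′ (b ∷ []))))
    ... | L , R , _ , crossing M sL≡ refl = ⊥-elim (valley-no-preimage L (d ∷ D′) M decD
            (Increasing-++⁻ˡ M (Increasing-++⁻ˡ (M ++ s R) incI)) (Below-++⁻ˡ M (Below-++⁻ˡ (M ++ s R) D<I))
            (long (length-++-≤ˡ M)) sL≡)
    ... | L , R , _ , empty-left _ sR≡ = ⊥-elim (valley-no-preimage R (d ∷ D′) I′ decD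
            (Increasing-++⁻ˡ I′ incI) (Below-++⁻ˡ I′ D<I) (long ≤-refl) sR≡)
    ... | L , R , refl , single-left _ _ refl refl sR≡ = cong (λ R → d ∷ b ∷ R) (unique′ R sR≡)

valley-determined : ∀ {u v} → Valley u → Valley v → u ↭ v → u ≡ v
valley-determined (D , I , isValley decD incI D<I lenD , refl) (D′ , I′ , isValley decD′ incI′ D′<I′ lenD′ , refl) u↭v
  with ++-injective-length (reverse D) I (reverse D′) I′ lengths sorted
  where
  sorted-entries : ∀ {D I} → Decreasing D → Increasing I → Below D I → Increasing (reverse D ++ I)
  sorted-entries {D} decD incI D<I = AllPairsₚ.++⁺ (AllPairs-reverse decD) incI (All-resp-↭ (↭-sym (↭-reverse D)) D<I)
  sorted : reverse D ++ I ≡ reverse D′ ++ I′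
  sorted = increasing-↭⇒≡ (sorted-entries decD incI D<I) (sorted-entries decD′ incI′ D′<I′)
             (↭-trans (++⁺ʳ I (↭-reverse D)) (↭-trans u↭v (↭-sym (++⁺ʳ I′ (↭-reverse D′)))))
  total : length I + length I ≡ length I′ + length I′
  total = suc-injective (begin
    suc (length I + length I)  ≡⟨ cong (_+ length I) lenD ⟨
    length D + length I        ≡⟨ length-++ D ⟨
    length (D ++ I)            ≡⟨ ↭-length u↭v ⟩
    length (D′ ++ I′)          ≡⟨ length-++ D′ ⟩
    length D′ + length I′      ≡⟨ cong (_+ length I′) lenD′ ⟩
    suc (length I′ + length I′) ∎)
    where open ≡-Reasoning
  lenI : length I ≡ length I′
  lenI = trans (n≡⌊n+n/2⌋ _) (trans (cong ⌊_/2⌋ total) (sym (n≡⌊n+n/2⌋ _)))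
  lengths : length (reverse D) ≡ length (reverse D′)
  lengths = trans (length-reverse D) (trans lenD (trans (cong suc lenI) (sym (trans (length-reverse D′) lenD′))))
... | rev≡ , refl = cong (_++ I) (reverse-injective rev≡)

valley-singleton : ∀ m → Valley (m ∷ [])
valley-singleton m = m ∷ [] , [] , isValley ([] ∷ []) [] ([] ∷ []) refl , refl

-- A top entry a preceded by a smaller x forces B above a (else x a y is a 132 or a 231),
-- so A would lie below B.
ascent-before-top : ∀ {A B m x a} → UniqueSplit A B m → B ≢ [] → (x ∷ a ∷ []) ⊆ A → x < a → All (_≤ a) A →
  Avoids (A ++ B ++ m ∷ []) p132 → Avoids (A ++ B ++ m ∷ []) p231 → ⊥
ascent-before-top {x = x} {a} split B≢[] xa⊆A x<a A≤a av132 av231 =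
  ¬Below split B≢[] (All.map (λ z≤a → All.map (≤-<-trans z≤a) a<B) A≤a)
  where
  x∈A = ⊆-lookup xa⊆A (here refl)
  a∈A = ⊆-lookup xa⊆A (there (here refl))
  a<B = All.tabulate λ {y} y∈B → case ≶-across split a∈A y∈B of λ where
    (inj₁ a<y) → a<y
    (inj₂ y<a) → case ≶-across split x∈A y∈B of λ where
      (inj₁ x<y) → ⊥-elim (av132 (contains-132 (⊆-glue split xa⊆A (from∈ y∈B)) x<y y<a))
      (inj₂ y<x) → ⊥-elim (av231 (contains-231 (⊆-glue split xa⊆A (from∈ y∈B)) y<x x<a))

valley-glue-single : ∀ {a DB IB m} → UniqueSplit (a ∷ []) (DB ++ IB) m → IsValley DB IB →
  All (Avoids ((a ∷ []) ++ (DB ++ IB) ++ m ∷ [])) (p132 ∷ p231 ∷ p312 ∷ []) → Valley ((a ∷ []) ++ (DB ++ IB) ++ m ∷ [])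
valley-glue-single {a} {b ∷ []} {[]} {m} split _ _ with ≶-across split (here refl) (here refl)
... | inj₁ a<b = ⊥-elim (¬Below split ∷≢[] ((a<b ∷ []) ∷ []))
... | inj₂ b<a = a ∷ b ∷ [] , m ∷ [] , isValley ((b<a ∷ []) ∷ [] ∷ []) ([] ∷ []) ((a<m ∷ []) ∷ (b<m ∷ []) ∷ []) refl , refl
  where
  a<m = All.head (UniqueSplit.A<m split)
  b<m = All.head (UniqueSplit.B<m split)
valley-glue-single {a} {d ∷ d′ ∷ DB} {i ∷ IB} {m} split (isValley decB@((d′<d ∷ _) ∷ _) incB DB<IB lenB)
                   (av132 ∷ av231 ∷ av312 ∷ [])
  with ≶-across split (here refl) (here refl)
... | inj₁ a<d = case ≶-across split (here refl) (there (here refl)) of λ where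
  (inj₁ a<d′) → ⊥-elim (av132 (contains-132 (⊆-glue split ⊆-refl (refl ∷ refl ∷ minimum (DB ++ i ∷ IB))) a<d′ d′<d))
  (inj₂ d′<a) → ⊥-elim (av231 (contains-231 (⊆-glue split ⊆-refl (refl ∷ refl ∷ minimum (DB ++ i ∷ IB))) d′<a a<d))
... | inj₂ d<a with ≶-across split (here refl) (∈-++⁺ʳ (d ∷ d′ ∷ DB) (here refl))
...   | inj₂ i<a = ⊥-elim (av312 (contains-312 (⊆-glue split ⊆-refl (refl ∷ from∈ (∈-++⁺ʳ (d′ ∷ DB) (here refl))))
                                    (All.head (All.head DB<IB)) i<a))
...   | inj₁ a<i = a ∷ d ∷ d′ ∷ DB , (i ∷ IB) ++ m ∷ [] ,
  isValley (a>DB ∷ decB) (AllPairsₚ.++⁺ incB ([] ∷ []) (All.map (_∷ []) IB<m))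
           (All.++⁺ (a<i ∷ All.map (<-trans a<i) (AllPairs.head incB)) (a<m ∷ [])
             ∷ All.tabulate (λ x∈ → All.++⁺ (All.lookup DB<IB x∈) (All.lookup DB<m x∈ ∷ [])))
           (cong suc (trans lenB (sym (length-∷ʳ (i ∷ IB)))))
  , cong (a ∷_) (++-assoc (d ∷ d′ ∷ DB) (i ∷ IB) (m ∷ []))
  where
  a<m = All.head (UniqueSplit.A<m split)
  DB<m = All.++⁻ˡ (d ∷ d′ ∷ DB) (UniqueSplit.B<m split)
  IB<m = All.++⁻ʳ (d ∷ d′ ∷ DB) (UniqueSplit.B<m split)
  a>DB : All (_< a) (d ∷ d′ ∷ DB)
  a>DB = d<a ∷ All.map (λ x<d → <-trans x<d d<a) (AllPairs.head decB)

valley-glue : ∀ {A B m} → UniqueSplit A B m → All (Avoids (A ++ B ++ m ∷ [])) (p132 ∷ p231 ∷ p312 ∷ []) →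
  Valley A → Valley B → Valley (A ++ B ++ m ∷ [])
valley-glue split avs (DA , IA , vA , refl) (DB , IB , vB , refl) with []-or-∷ʳ IA
valley-glue split avs (a ∷ [] , _ , _ , refl) (DB , IB , vB , refl) | inj₁ refl = valley-glue-single split vB avs
valley-glue split (av132 ∷ av231 ∷ _) (x ∷ DA , _ , isValley _ incA DA<IA _ , refl) (DB , IB , vB , refl)
  | inj₂ (IA′ , a , refl) =
  ⊥-elim (ascent-before-top split (B≢[] vB) (refl ∷ from∈ a∈) (All.lookup (All.head DA<IA) (∈-++⁺ʳ IA′ (here refl)))
                            A≤a av132 av231)
  where
  a∈ : a ∈ DA ++ IA′ ++ a ∷ []
  a∈ = ∈-++⁺ʳ DA (∈-++⁺ʳ IA′ (here refl))
  A≤a : All (_≤ a) (x ∷ DA ++ IA′ ++ a ∷ [])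
  A≤a = All.++⁺ (All.map (λ y<IA → <⇒≤ (All.lookup y<IA (∈-++⁺ʳ IA′ (here refl)))) DA<IA)
                (All.++⁺ (All.map (<⇒≤ ∘′ All.head) (proj₂ (proj₂ (AllPairs-++⁻ IA′ incA)))) (≤-refl ∷ []))
  B≢[] : ∀ {D I} → IsValley D I → D ++ I ≢ []
  B≢[] {_ ∷ _} _ ()

valley-triple : ∀ {D I a b c} → IsValley D I → (a ∷ b ∷ c ∷ []) ⊆ D ++ I →
  (a < b × b < c) ⊎ (b < a × a < c) ⊎ (b < a × c < b)
valley-triple {D} (isValley decD incI D<I _) abc⊆ with ⊆-split D abc⊆
... | [] , _ , refl , _ , p₂ with AllPairs-resp-⊆ p₂ incI
...   | (a<b ∷ _) ∷ (b<c ∷ []) ∷ [] ∷ [] = inj₁ (a<b , b<c)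
valley-triple {D} (isValley decD incI D<I _) abc⊆ | _ ∷ [] , _ , refl , p₁ , p₂ with AllPairs-resp-⊆ p₂ incI
...   | (b<c ∷ []) ∷ [] ∷ [] = inj₁ (Below-⊆ D<I p₁ p₂ (here refl) , b<c)
valley-triple {D} (isValley decD incI D<I _) abc⊆ | _ ∷ _ ∷ [] , _ , refl , p₁ , p₂ with AllPairs-resp-⊆ p₁ decD
...   | (b<a ∷ []) ∷ [] ∷ [] = inj₂ (inj₁ (b<a , Below-⊆ D<I p₁ p₂ (here refl)))
valley-triple {D} (isValley decD incI D<I _) abc⊆ | _ ∷ _ ∷ _ ∷ [] , [] , refl , p₁ , _ with AllPairs-resp-⊆ p₁ decD
...   | (b<a ∷ _) ∷ (c<b ∷ []) ∷ [] ∷ [] = inj₂ (inj₂ (b<a , c<b))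

valley-avoids : ∀ {D I t₁ t₂ t₃} → IsValley D I →
  ¬ (t₁ < t₂ × t₂ < t₃) → ¬ (t₂ < t₁ × t₁ < t₃) → ¬ (t₂ < t₁ × t₃ < t₂) → Avoids (D ++ I) (t₁ ∷ t₂ ∷ t₃ ∷ [])
valley-avoids v no123 no213 no321 (_ , σ⊆ , cons (r₁₂ ∷ r₁₃ ∷ []) (cons (r₂₃ ∷ []) _)) with valley-triple v σ⊆
... | inj₁ (a<b , b<c)        = no123 (Equivalence.to (proj₁ r₁₂) a<b , Equivalence.to (proj₁ r₂₃) b<c)
... | inj₂ (inj₁ (b<a , a<c)) = no213 (Equivalence.to (proj₂ r₁₂) b<a , Equivalence.to (proj₁ r₁₃) a<c)
... | inj₂ (inj₂ (b<a , c<b)) = no321 (Equivalence.to (proj₂ r₁₂) b<a , Equivalence.to (proj₂ r₂₃) c<b)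

-- The class of 132 and 321

SingletonOr213 : List ℕ → Set
SingletonOr213 w = (∃ λ x → w ≡ x ∷ []) ⊎ (∃₂ λ q p → ∃ λ r → p < q × q < r × w ≡ q ∷ p ∷ r ∷ [])

singletonOr213-glue : ∀ {A B m} → UniqueSplit A B m → All (Avoids (A ++ B ++ m ∷ [])) (p132 ∷ p321 ∷ []) →
  SingletonOr213 A → SingletonOr213 B → SingletonOr213 (A ++ B ++ m ∷ [])
singletonOr213-glue split _ (inj₁ (a , refl)) (inj₁ (b , refl)) with ≶-across split (here refl) (here refl)
... | inj₁ a<b = ⊥-elim (¬Below split ∷≢[] ((a<b ∷ []) ∷ []))
... | inj₂ b<a = inj₂ (a , b , _ , b<a , All.head (UniqueSplit.A<m split) , refl)
singletonOr213-glue split (_ ∷ av321 ∷ []) (inj₁ (x , refl)) (inj₂ (q , p , r , p<q , q<r , refl))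
  with ≶-across split (here refl) (there (here refl))
... | inj₁ x<p = ⊥-elim (¬Below split ∷≢[] ((<-trans x<p p<q ∷ x<p ∷ <-trans x<p (<-trans p<q q<r) ∷ []) ∷ []))
... | inj₂ p<x with ≶-across split (here refl) (here refl)
...   | inj₂ q<x = ⊥-elim (av321 (contains-321 (⊆-glue split ⊆-refl (refl ∷ refl ∷ r ∷ʳ [])) p<q q<x))
...   | inj₁ x<q with UniqueSplit.A-preimage split | UniqueSplit.B-preimage split
...     | X , sX , _ | Y , sY , _ with s-singleton⁻ X x sX
...       | refl with () ← preimage-factorisation-unique {u = x ∷ q ∷ p ∷ r ∷ []}
                          (UniqueSplit.whole-preimage split) (All.++⁺ (UniqueSplit.A<m split) (UniqueSplit.B<m split))
                          {X = x ∷ []} {Y = Y} {X′ = x ∷ q ∷ []} {Y′ = p ∷ r ∷ []}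
                          (cong₂ _++_ sX sY) (cong₂ _++_ (s-ascent x<q) (s-ascent (<-trans p<q q<r)))
singletonOr213-glue split (av132 ∷ av321 ∷ []) (inj₂ (q , p , r , p<q , q<r , refl)) (inj₁ (b , refl))
  with ≶-across split (there (there (here refl))) (here refl)
... | inj₁ r<b = ⊥-elim (¬Below split ∷≢[] ((<-trans q<r r<b ∷ []) ∷ (<-trans (<-trans p<q q<r) r<b ∷ []) ∷ (r<b ∷ []) ∷ []))
... | inj₂ b<r with ≶-across split (there (here refl)) (here refl)
...   | inj₁ p<b = ⊥-elim (av132 (contains-132 (⊆-glue split (q ∷ʳ ⊆-refl) ⊆-refl) p<b b<r))
...   | inj₂ b<p = ⊥-elim (av321 (contains-321 (⊆-glue split (refl ∷ refl ∷ r ∷ʳ []) ⊆-refl) b<p p<q))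
singletonOr213-glue split (av132 ∷ av321 ∷ []) (inj₂ (q , p , r , p<q , q<r , refl))
                                               (inj₂ (q′ , p′ , r′ , p′<q′ , q′<r′ , refl))
  with ≶-across split (there (there (here refl))) (there (here refl))
... | inj₁ r<p′ = ⊥-elim (¬Below split ∷≢[] (r<B (<⇒≤ q<r) ∷ r<B (<⇒≤ (<-trans p<q q<r)) ∷ r<B ≤-refl ∷ []))
  where
  r<B : ∀ {x} → x ≤ r → All (x <_) (q′ ∷ p′ ∷ r′ ∷ [])
  r<B x≤r = ≤-<-trans x≤r (<-trans r<p′ p′<q′) ∷ ≤-<-trans x≤r r<p′
          ∷ ≤-<-trans x≤r (<-trans r<p′ (<-trans p′<q′ q′<r′)) ∷ []
... | inj₂ p′<r with ≶-across split (there (here refl)) (there (here refl))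
...   | inj₁ p<p′ = ⊥-elim (av132 (contains-132 (⊆-glue split (q ∷ʳ ⊆-refl) (q′ ∷ʳ refl ∷ r′ ∷ʳ [])) p<p′ p′<r))
...   | inj₂ p′<p = ⊥-elim (av321 (contains-321 (⊆-glue split (refl ∷ refl ∷ r ∷ʳ []) (q′ ∷ʳ refl ∷ r′ ∷ʳ [])) p′<p p<q))

canonicalPairs : ℕ → Pairs
canonicalPairs zero    = []
canonicalPairs (suc k) = (suc (2 * k) , 2 + 2 * k) ∷ canonicalPairs k

pairEntries-canonical : ∀ k → pairEntries (canonicalPairs k) ≡ oneTo (2 * k)
pairEntries-canonical zero    = refl
pairEntries-canonical (suc k) = begin
  pairEntries (canonicalPairs k) ++ suc (2 * k) ∷ 2 + 2 * k ∷ []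
    ≡⟨ cong (_++ suc (2 * k) ∷ 2 + 2 * k ∷ []) (pairEntries-canonical k) ⟩
  oneTo (2 * k) ++ suc (2 * k) ∷ 2 + 2 * k ∷ []                  ≡⟨ ++-assoc (oneTo (2 * k)) _ _ ⟨
  (oneTo (2 * k) ++ suc (2 * k) ∷ []) ++ 2 + 2 * k ∷ []          ≡⟨ cong (_++ 2 + 2 * k ∷ []) (oneTo-∷ʳ (2 * k)) ⟨
  oneTo (suc (2 * k)) ++ 2 + 2 * k ∷ []                          ≡⟨ oneTo-∷ʳ (suc (2 * k)) ⟨
  oneTo (2 + 2 * k)                                              ≡⟨ cong oneTo (*-suc 2 k) ⟨
  oneTo (2 * suc k)                                              ∎
  where open ≡-Reasoning

canonicalPairs-isLayering : ∀ k {z} → 2 * k < z → IsLayering (canonicalPairs k) z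
canonicalPairs-isLayering zero    _   = tt
canonicalPairs-isLayering (suc k) {z} 2k<z =
  canonicalPairs-isLayering k (n≤1+n _) ,
  subst (All (_< suc (2 * k))) (sym (pairEntries-canonical k)) (oneTo-< (2 * k)) ,
  n<1+n _ ,
  subst (_< z) (*-suc 2 k) 2k<z

-- The layered word 2 1 4 3 … 2k (2k−1) (2k+1).
layeredWitness : ℕ → List ℕ
layeredWitness k = layered (canonicalPairs k) (suc (2 * k))

layeredWitness-layered : ∀ k → Layered (layeredWitness k)
layeredWitness-layered k = canonicalPairs k , suc (2 * k) , canonicalPairs-isLayering k ≤-refl , refl

layeredWitness-perm : ∀ k → IsPerm (suc (2 * k)) (layeredWitness k)
layeredWitness-perm k = ↭-trans (layered-↭ (canonicalPairs k) (suc (2 * k)))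
  (↭-reflexive (trans (cong (_++ suc (2 * k) ∷ []) (pairEntries-canonical k)) (sym (oneTo-∷ʳ (2 * k)))))

layeredWitness-avoids : ∀ k {t₁ t₂ t₃} → t₃ < t₁ → Avoids (layeredWitness k) (t₁ ∷ t₂ ∷ t₃ ∷ [])
layeredWitness-avoids k = layered-avoids (canonicalPairs k) _ (canonicalPairs-isLayering k ≤-refl)

layered-witness-∈ : ∀ k {τs} → All (Avoids (layeredWitness k)) τs → InU (suc (2 * k)) τs (layeredWitness k)
layered-witness-∈ k avs = layeredWitness-perm k ,
  UniquePreimage⇒UniquelySorted (layeredWitness-perm k) (layered-preimage (canonicalPairs k) _ (canonicalPairs-isLayering k ≤-refl)) ,
  avs

valleyWitness : ℕ → List ℕ
valleyWitness k = reverse (take (suc k) (oneTo (suc (2 * k)))) ++ drop (suc k) (oneTo (suc (2 * k)))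

valleyWitness-valley : ∀ k → Valley (valleyWitness k)
valleyWitness-valley k
  with AllPairs-++⁻ (take (suc k) N) (subst Increasing (sym (take++drop≡id (suc k) N)) (oneTo-increasing (suc (2 * k))))
  where N = oneTo (suc (2 * k))
... | incT , incD , T<D =
  _ , _ , isValley (AllPairs-reverse incT) incD (All-resp-↭ (↭-sym (↭-reverse (take (suc k) N))) T<D) lengths , refl
  where
  N = oneTo (suc (2 * k))
  lengths : length (reverse (take (suc k) N)) ≡ suc (length (drop (suc k) N))
  lengths = begin
    length (reverse (take (suc k) N)) ≡⟨ length-reverse (take (suc k) N) ⟩
    length (take (suc k) N)           ≡⟨ length-take (suc k) N ⟩
    suc k ⊓ length N                  ≡⟨ cong (suc k ⊓_) (oneTo-length (suc (2 * k))) ⟩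
    suc k ⊓ suc (2 * k)               ≡⟨ m≤n⇒m⊓n≡m (s≤s (m≤m+n k _)) ⟩
    suc k                             ≡⟨ cong suc (trans (sym (+-identityʳ k)) (sym (m+n∸m≡n k (k + 0)))) ⟩
    suc (suc (2 * k) ∸ suc k)         ≡⟨ cong (λ n → suc (n ∸ suc k)) (oneTo-length (suc (2 * k))) ⟨
    suc (length N ∸ suc k)            ≡⟨ cong suc (length-drop (suc k) N) ⟨
    suc (length (drop (suc k) N))     ∎
    where open ≡-Reasoning

valleyWitness-perm : ∀ k → IsPerm (suc (2 * k)) (valleyWitness k)
valleyWitness-perm k = ↭-trans (++⁺ʳ (drop (suc k) N) (↭-reverse (take (suc k) N))) (↭-reflexive (take++drop≡id (suc k) N))
  where N = oneTo (suc (2 * k))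

valley-witness-∈ : ∀ k → InU (suc (2 * k)) (p132 ∷ p231 ∷ p312 ∷ []) (valleyWitness k)
valley-witness-∈ k with valleyWitness-valley k
... | D , I , v , w≡ = valleyWitness-perm k ,
  UniquePreimage⇒UniquelySorted (valleyWitness-perm k) (subst UniquePreimage (sym w≡) (valley-preimage v)) ,
  subst (λ w → All (Avoids w) (p132 ∷ p231 ∷ p312 ∷ [])) (sym w≡)
    (valley-avoids v (λ (_ , 3<2) → <-asym 2<3 3<2) (λ (3<1 , _) → <-asym 1<3 3<1) (λ (3<1 , _) → <-asym 1<3 3<1) ∷
     valley-avoids v (λ (_ , 3<1) → <-asym 1<3 3<1) (λ (3<2 , _) → <-asym 2<3 3<2) (λ (3<2 , _) → <-asym 2<3 3<2) ∷
     valley-avoids v (λ (3<1 , _) → <-asym 1<3 3<1) (λ (_ , 3<2) → <-asym 2<3 3<2) (λ (_ , 2<1) → <-asym 1<2 2<1) ∷ [])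

InU-mono : ∀ {n τs τs′ π} → τs′ ⊆ τs → InU n τs π → InU n τs′ π
InU-mono τs′⊆τs (pπ , us , avs) = pπ , us , ⊆.All-resp-⊆ τs′⊆τs avs

exactlyOne : ∀ {n τs} {Shape : List ℕ → Set} → (∀ {u v} → Shape u → Shape v → u ↭ v → u ≡ v) →
  (∀ π → InU n τs π → Shape π) → ∀ W → Shape W → InU n τs W → ExactlyOne (InU n τs)
exactlyOne determined classify W W-shape W∈ =
  W , W∈ , λ π π∈ → determined (classify π π∈) W-shape (↭-trans (proj₁ π∈) (↭-sym (proj₁ W∈)))

layered-231-321 : ∀ n π → InU (suc n) (p231 ∷ p321 ∷ []) π → Layered π
layered-231-321 = InU⇒Shape Layered _ layered-singleton layered-glue-231-321

layered-312-321 : ∀ n π → InU (suc n) (p312 ∷ p321 ∷ []) π → Layered π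
layered-312-321 = InU⇒Shape Layered _ layered-singleton layered-glue-312-321

valley-132-231-312 : ∀ n π → InU (suc n) (p132 ∷ p231 ∷ p312 ∷ []) π → Valley π
valley-132-231-312 = InU⇒Shape Valley _ valley-singleton valley-glue

singletonOr213-132-321 : ∀ n π → InU (suc n) (p132 ∷ p321 ∷ []) π → SingletonOr213 π
singletonOr213-132-321 = InU⇒Shape SingletonOr213 _ (λ m → inj₁ (m , refl)) singletonOr213-glue

exactlyOne-layered : ∀ k {τs} → (∀ π → InU (suc (2 * k)) τs π → Layered π) →
  All (Avoids (layeredWitness k)) τs → ExactlyOne (InU (suc (2 * k)) τs)
exactlyOne-layered k classify avs =
  exactlyOne layered-determined classify (layeredWitness k) (layeredWitness-layered k) (layered-witness-∈ k avs)

no-132-321 : ∀ k → 2 ≤ k → (π : List ℕ) → ¬ InU (suc (2 * k)) (p132 ∷ p321 ∷ []) π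
no-132-321 k 2≤k π π∈@(pπ , _) with singletonOr213-132-321 (2 * k) π π∈ | five≤length
  where
  five≤length : 5 ≤ length π
  five≤length = subst (5 ≤_) (sym (trans (↭-length pπ) (oneTo-length _))) (s≤s (*-monoʳ-≤ 2 2≤k))
... | inj₁ (_ , refl)                 | s≤s ()
... | inj₂ (_ , _ , _ , _ , _ , refl) | s≤s (s≤s (s≤s ()))

theorem10p1 : ((k : ℕ) →
                  ExactlyOne (InU (suc (2 * k)) (p231 ∷ p321 ∷ []))
                  × ExactlyOne (InU (suc (2 * k)) (p312 ∷ p321 ∷ []))
                  × ExactlyOne (InU (suc (2 * k)) (p231 ∷ p312 ∷ p321 ∷ []))
                  × ExactlyOne (InU (suc (2 * k)) (p132 ∷ p231 ∷ p312 ∷ [])))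
                × ((k : ℕ) → 2 ≤ k → (π : List ℕ) → ¬ InU (suc (2 * k)) (p132 ∷ p321 ∷ []) π)
theorem10p1 =
  (λ k → exactlyOne-layered k (layered-231-321 _) (avoids k 1<2 ∷ avoids k 1<3 ∷ [])
       , exactlyOne-layered k (layered-312-321 _) (avoids k 2<3 ∷ avoids k 1<3 ∷ [])
       , exactlyOne-layered k (λ π → layered-231-321 _ π ∘′ InU-mono (refl ∷ p312 ∷ʳ refl ∷ []))
                              (avoids k 1<2 ∷ avoids k 2<3 ∷ avoids k 1<3 ∷ [])
       , exactlyOne valley-determined (valley-132-231-312 _) (valleyWitness k) (valleyWitness-valley k) (valley-witness-∈ k))
  , no-132-321
  where avoids = layeredWitness-avoids
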